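{- Define $$\theta_1(N)=\frac{\sqrt N}{\psi^{\mathrm{new}}(N)\pi_2(N)^2},\quad\theta_2(N)=\frac{4^{\omega(N)}}{\psi^{\mathrm{new}}(N)},\quad\theta_3(N)=\frac{2^{\omega(N)}}{\psi^{\mathrm{new}}(N)},\quad\theta_4(N)=\frac1{\psi^{\mathrm{new}}(N)}.$$ Then each $\theta_i(N)\to0$ as $N\to\infty$.
   Context: $\psi(N)=N\prod_{p\mid N}(1+1/p)$; $\beta$ is multiplicative with $\beta(p)=-2$, $\beta(p^2)=1$, $\beta(p^r)=0$ for $r\ge3$; $\psi^{\mathrm{new}}(N)=\sum_{M\mid N}\beta(N/M)\psi(M)$. $\pi_2(N)=\prod_{p\mid N}(1+\frac1{p-1})$, and $\omega(N)$ is the number of distinct prime divisors of $N$. -}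

module Defs where

open import Data.Nat as ℕ using (ℕ; zero; suc)
open import Data.Nat.Divisibility using (_∣?_)
open import Data.Nat.Primality using (prime?)
open import Data.List using (List; filter; map; foldr; upTo; length)
open import Data.Integer as ℤ using (ℤ; +_)
open import Data.Rational as ℚ using (ℚ; 0ℚ; 1ℚ; _+_; _*_; _-_; 1/_; ≢-nonZero)
open import Data.Rational.Properties using (_≟_)
open import Relation.Nullary using (yes; no)
open import Relation.Nullary.Decidable using (_×-dec_)

prodℚ : List ℚ → ℚ
prodℚ = foldr _*_ 1ℚ

sumℚ : List ℚ → ℚ
sumℚ = foldr _+_ 0ℚ

-- total reciprocal on ℚ (equals 1/q whenever q ≠ 0; never used at 0 below)
recip : ℚ → ℚ
recip q with q ≟ 0ℚ
... | yes _ = 0ℚ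
... | no ne = 1/_ q {{≢-nonZero ne}}

primeDivisors : ℕ → List ℕ
primeDivisors N = filter (λ p → prime? p ×-dec (p ∣? N)) (upTo (suc N))

ω : ℕ → ℕ
ω N = length (primeDivisors N)

-- the factor 1 + 1/p, and p/(p-1) = 1 + 1/(p-1), for a prime p (p = 0,1 never occur)
onePlusInv : ℕ → ℚ
onePlusInv zero    = 1ℚ
onePlusInv (suc q) = 1ℚ + ℚ._/_ (+ 1) (suc q)

pOverPm1 : ℕ → ℚ
pOverPm1 zero          = 1ℚ
pOverPm1 (suc zero)    = 1ℚ
pOverPm1 (suc (suc q)) = 1ℚ + ℚ._/_ (+ 1) (suc q)

ψ : ℕ → ℚ
ψ N = ℚ._/_ (+ N) 1 * prodℚ (map onePlusInv (primeDivisors N))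

π₂ : ℕ → ℚ
π₂ N = prodℚ (map pOverPm1 (primeDivisors N))

-- local factor of β at a prime p dividing n, determined by v_p(n):
-- v_p = 1 ↦ -2, v_p = 2 ↦ 1, v_p ≥ 3 ↦ 0
βlocal : ℕ → ℕ → ℚ
βlocal n p with (p ℕ.^ 3) ∣? n
... | yes _ = 0ℚ
... | no _ with (p ℕ.^ 2) ∣? n
...   | yes _ = 1ℚ
...   | no _  = ℚ.-_ (1ℚ + 1ℚ)

β : ℕ → ℚ
β n = prodℚ (map (βlocal n) (primeDivisors n))

-- ψ^new(N) = Σ_{M | N} β(N/M) ψ(M), M ranging over the positive divisors of N
ψnew : ℕ → ℚ
ψnew N = sumℚ (map (λ d → β (N ℕ./ suc d) * ψ (suc d))
                   (filter (λ d → suc d ∣? N) (upTo N)))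

-- θ₁(N)² = N / (ψ^new(N)² π₂(N)⁴)   (θ₁ itself involves √N)
θ₁² : ℕ → ℚ
θ₁² N = ℚ._/_ (+ N) 1 * recip (ψnew N * ψnew N * (π₂ N * π₂ N * (π₂ N * π₂ N)))

θ₂ : ℕ → ℚ
θ₂ N = ℚ._/_ (+ (4 ℕ.^ ω N)) 1 * recip (ψnew N)

θ₃ : ℕ → ℚ
θ₃ N = ℚ._/_ (+ (2 ℕ.^ ω N)) 1 * recip (ψnew N)

θ₄ : ℕ → ℚ
θ₄ N = recip (ψnew N)

TendsToZero : (ℕ → ℚ) → Set
TendsToZero f = ∀ (ε : ℚ) → 0ℚ ℚ.< ε →
  Data.Product.∃ λ M → ∀ N → 1 ℕ.≤ N → M ℕ.≤ N → ℚ.∣ f N ∣ ℚ.< ε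
  where import Data.Product

module Submission where

-- Both ψnew = β ⋆ ψ (a Dirichlet convolution of multiplicative functions) and π₂ are
-- multiplicative, and at a prime power p^r
--   ψnew(p) = p − 1,  ψnew(p²) = p² − p − 1,  ψnew(p^r) = p^(r−3) (p + 1) (p − 1)²  (r ≥ 3),
-- while π₂(p^r) = p/(p − 1); in each case p^r ≤ ψnew(p^r) π₂(p^r)².  Hence N ≤ ψnew(N) π₂(N)²
-- for every N ≥ 1, so θ₁(N)² ≤ 1/N, and with π₂(N) ≤ 2^ω(N) also θ₂(N) ≤ 16^ω(N)/N; θ₃ and θ₄
-- are at most θ₂.  Finally 16^ω(N) = o(N): the ω(N) distinct primes dividing N multiply to at
-- most N but to at least ω(N)!, which gives 256^ω(N) ≤ 256^256 N.

open import Defs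
open import Data.Nat.Base as ℕ using (ℕ; zero; suc; NonZero; 2+)
open import Data.Nat.Coprimality as Coprimality using (Coprime)
open import Data.Nat.Primality using (Prime)
open import Data.Product using (_×_; _,_; proj₁; proj₂; ∃-syntax)
open import Data.List using (List; []; _∷_; map)
open import Data.List.Membership.Propositional using (_∈_)
open import Relation.Binary.PropositionalEquality

private variable
  A B : Set
  xs ys : List A
  a b d i j m n p q x y x′ y′ : ℕ

-- Primes, coprimality and prime powers

module _ where
  open import Data.Nat.Base using (_+_; _*_; _^_; _∸_; _≤_; _<_; z≤n; s≤s; z<s; >-nonZero; nonTrivial⇒n>1)
  open import Data.Nat.Properties
  open import Data.Nat.Divisibility
  open import Data.Nat.GCD using (gcd; gcd[m,n]∣m; gcd[m,n]∣n; gcd-greatest; c*gcd[m,n]≡gcd[cm,cn])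
  open import Data.Nat.LCM using (lcm; lcm-least; gcd*lcm)
  open import Data.Nat.Coprimality using (coprime-divisor; coprime⇒gcd≡1; 1-coprimeTo)
  open import Data.Nat.Primality
  open import Data.Nat.Primality.Factorisation using (factorise)
  open import Data.Nat.ListAction using (product)
  open import Data.Nat.Induction using (<-rec)
  open import Data.List using (length)
  open import Data.List.Relation.Unary.All using (All; []; _∷_)
  open import Data.List.Relation.Unary.AllPairs using (AllPairs; []; _∷_)
  open import Data.Sum using (inj₁; inj₂)
  open import Relation.Nullary using (¬_; yes; no; contradiction)

  prime>1 : Prime p → 1 < p
  prime>1 {p} p-prime = nonTrivial⇒n>1 p {{prime⇒nonTrivial p-prime}}

  prime∣prime⇒≡ : Prime p → Prime q → p ∣ q → p ≡ q
  prime∣prime⇒≡ p-prime q-prime p∣q with prime⇒irreducible q-prime p∣q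
  ... | inj₁ refl = contradiction p-prime ¬prime[1]
  ... | inj₂ p≡q  = p≡q

  prime∤⇒coprime : Prime p → ¬ p ∣ n → Coprime p n
  prime∤⇒coprime p-prime p∤n (d∣p , d∣n) with prime⇒irreducible p-prime d∣p
  ... | inj₁ d≡1  = d≡1
  ... | inj₂ refl = contradiction d∣n p∤n

  coprime-∣ : Coprime a b → x ∣ a → y ∣ b → Coprime x y
  coprime-∣ a⊥b x∣a y∣b (d∣x , d∣y) = a⊥b (∣-trans d∣x x∣a , ∣-trans d∣y y∣b)

  coprime-*ˡ : Coprime a n → Coprime b n → Coprime (a * b) n
  coprime-*ˡ a⊥n b⊥n (d∣ab , d∣n) =
    b⊥n (coprime-divisor (coprime-∣ (Coprimality.sym a⊥n) d∣n ∣-refl) d∣ab , d∣n)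

  coprime-^ˡ : ∀ k → Coprime a n → Coprime (a ^ k) n
  coprime-^ˡ zero    _   = 1-coprimeTo _
  coprime-^ˡ (suc k) a⊥n = coprime-*ˡ a⊥n (coprime-^ˡ k a⊥n)

  coprime⇒*∣ : Coprime a b → a ∣ n → b ∣ n → a * b ∣ n
  coprime⇒*∣ {a} {b} a⊥b a∣n b∣n = subst (_∣ _) lcm≡a*b (lcm-least a∣n b∣n)
    where
    lcm≡a*b : lcm a b ≡ a * b
    lcm≡a*b = trans (sym (*-identityˡ (lcm a b)))
                    (trans (cong (_* lcm a b) (sym (coprime⇒gcd≡1 a⊥b))) (gcd*lcm a b))

  ∣*⇒≡gcd*gcd : Coprime a b → d ∣ a * b → d ≡ gcd d a * gcd d b
  ∣*⇒≡gcd*gcd {a} {b} {d} a⊥b d∣ab = ∣-antisym d∣uv uv∣d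
    where
    u v : ℕ
    u = gcd d a
    v = gcd d b
    uv∣d : u * v ∣ d
    uv∣d = coprime⇒*∣ (coprime-∣ a⊥b (gcd[m,n]∣n d a) (gcd[m,n]∣n d b)) (gcd[m,n]∣m d a) (gcd[m,n]∣m d b)
    -- d divides gcd (b * d) (b * a) = b * u, hence also gcd (u * d) (u * b) = u * v.
    d∣bu : d ∣ b * u
    d∣bu = subst (d ∣_) (sym (c*gcd[m,n]≡gcd[cm,cn] b d a))
                 (gcd-greatest (n∣m*n b) (subst (d ∣_) (*-comm a b) d∣ab))
    d∣uv : d ∣ u * v
    d∣uv = subst (d ∣_) (sym (c*gcd[m,n]≡gcd[cm,cn] u d b))
                 (gcd-greatest (n∣m*n u) (subst (d ∣_) (*-comm b u) d∣bu))

  coprime-factors-unique : Coprime a b → x ∣ a → y ∣ b → x′ ∣ a → y′ ∣ b → .{{NonZero x}} →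
                           x * y ≡ x′ * y′ → x ≡ x′ × y ≡ y′
  coprime-factors-unique {x = x} {y} {x′} {y′} a⊥b x∣a y∣b x′∣a y′∣b xy≡x′y′ = x≡x′ , y≡y′
    where
    x≡x′ : x ≡ x′
    x≡x′ = ∣-antisym
      (coprime-divisor (coprime-∣ a⊥b x∣a y′∣b) (subst (x ∣_) (trans xy≡x′y′ (*-comm x′ y′)) (m∣m*n y)))
      (coprime-divisor (coprime-∣ a⊥b x′∣a y∣b) (subst (x′ ∣_) (trans (sym xy≡x′y′) (*-comm x y)) (m∣m*n y′)))
    y≡y′ : y ≡ y′
    y≡y′ = *-cancelˡ-≡ y y′ x (trans xy≡x′y′ (cong (_* y′) (sym x≡x′)))

  ^-distribʳ-* : ∀ m n k → (m * n) ^ k ≡ m ^ k * n ^ k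
  ^-distribʳ-* m n zero    = refl
  ^-distribʳ-* m n (suc k) =
    trans (cong (m * n *_) (^-distribʳ-* m n k)) ([m*n]*[o*p]≡[m*o]*[n*p] m n (m ^ k) (n ^ k))

  ^-monoʳ-∣ : ∀ p {i j} → i ≤ j → p ^ i ∣ p ^ j
  ^-monoʳ-∣ p {i} {j} i≤j = divides (p ^ (j ∸ i))
    (trans (cong (p ^_) (sym (m∸n+n≡m i≤j))) (^-distribˡ-+-* p (j ∸ i) i))

  ^∣^⇒≤ : 1 < p → ∀ i j → p ^ i ∣ p ^ j → i ≤ j
  ^∣^⇒≤ {p} 1<p i j p^i∣p^j = ≮⇒≥ λ j<i →
    <-irrefl refl (<-≤-trans (^-monoʳ-< p 1<p j<i) (∣⇒≤ {{m^n≢0 p j}} p^i∣p^j))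
    where
    instance
      _ : NonZero p
      _ = >-nonZero (<-trans z<s 1<p)

  ^-injectiveʳ : 1 < p → p ^ i ≡ p ^ j → i ≡ j
  ^-injectiveʳ {i = i} {j} 1<p p^i≡p^j =
    ≤-antisym (^∣^⇒≤ 1<p i j (∣-reflexive p^i≡p^j)) (^∣^⇒≤ 1<p j i (∣-reflexive (sym p^i≡p^j)))

  prime∣^⇒∣ : ∀ k → Prime q → q ∣ p ^ k → q ∣ p
  prime∣^⇒∣ zero    q-prime q∣1 = contradiction (subst Prime (∣1⇒≡1 q∣1) q-prime) ¬prime[1]
  prime∣^⇒∣ {p = p} (suc k) q-prime q∣p^k+1 with euclidsLemma p (p ^ k) q-prime q∣p^k+1
  ... | inj₁ q∣p   = q∣p
  ... | inj₂ q∣p^k = prime∣^⇒∣ k q-prime q∣p^k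

  ∣prime^⇒≡prime^ : Prime p → ∀ r → d ∣ p ^ r → ∃[ i ] i ≤ r × d ≡ p ^ i
  ∣prime^⇒≡prime^ p-prime zero d∣1 = 0 , z≤n , ∣1⇒≡1 d∣1
  ∣prime^⇒≡prime^ {p} {d} p-prime (suc r) d∣p^r+1 with p ∣? d
  ... | no p∤d =
    let i , i≤r , d≡p^i = ∣prime^⇒≡prime^ p-prime r
                            (coprime-divisor (Coprimality.sym (prime∤⇒coprime p-prime p∤d)) d∣p^r+1)
    in i , m≤n⇒m≤1+n i≤r , d≡p^i
  ... | yes (divides e refl) =
    let i , i≤r , e≡p^i = ∣prime^⇒≡prime^ p-prime r
                            (*-cancelˡ-∣ p {{prime⇒nonZero p-prime}} (subst (_∣ p ^ suc r) (*-comm e p) d∣p^r+1))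
    in suc i , s≤s i≤r , trans (*-comm e p) (cong (p *_) e≡p^i)

  ∃prime∣ : ∀ n → .{{NonZero n}} → 1 < n → ∃[ p ] Prime p × p ∣ n
  ∃prime∣ n 1<n with factorise n
  ... | record { factors = [] ; isFactorisation = n≡1 } = contradiction 1<n (<-irrefl (sym n≡1))
  ... | record { factors = p ∷ ps ; isFactorisation = n≡p*ps ; factorsPrime = p-prime ∷ _ } =
    p , p-prime , subst (p ∣_) (sym n≡p*ps) (m∣m*n (product ps))

  prime-power-split : Prime p → ∀ n → .{{NonZero n}} → ∃[ r ] ∃[ m ] n ≡ p ^ r * m × ¬ p ∣ m
  prime-power-split {p} p-prime = <-rec Split split
    where
    Split : ℕ → Set
    Split n = .{{NonZero n}} → ∃[ r ] ∃[ m ] n ≡ p ^ r * m × ¬ p ∣ m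
    split : ∀ n → (∀ {q} → q < n → Split q) → Split n
    split n rec with p ∣? n
    ... | no p∤n = 0 , n , sym (*-identityˡ n) , p∤n
    ... | yes (divides q refl) =
      let instance _ = m*n≢0⇒m≢0 q
          r , m , q≡p^r*m , p∤m = rec (m<m*n q p (prime>1 p-prime))
      in suc r , m , trans (cong (_* p) q≡p^r*m) (trans (*-comm (p ^ r * m) p) (sym (*-assoc p (p ^ r) m)))
       , p∤m

  prime-power-induction : (P : ℕ → Set) → P 1 → (∀ {p} k → Prime p → P (p ^ suc k)) →
    (∀ {a b} .{{_ : NonZero a}} .{{_ : NonZero b}} → Coprime a b → P a → P b → P (a * b)) →
    ∀ n → .{{NonZero n}} → P n
  prime-power-induction P P[1] P[p^k+1] P[ab] = <-rec (λ n → .{{NonZero n}} → P n) step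
    where
    step : ∀ n → (∀ {m} → m < n → .{{NonZero m}} → P m) → .{{NonZero n}} → P n
    step 1                 _   = P[1]
    step n@(2+ _) rec with ∃prime∣ n (s≤s (s≤s z≤n))
    ... | p , p-prime , p∣n with prime-power-split p-prime n
    ...   | zero  , m , n≡m , p∤m = contradiction (subst (p ∣_) (trans n≡m (*-identityˡ m)) p∣n) p∤m
    ...   | suc k , m , n≡p^k+1*m , p∤m =
      subst P (sym n≡p^k+1*m) (P[ab] p^k+1⊥m (P[p^k+1] k p-prime) (rec m<n))
      where
      p^≢0 : ∀ i → NonZero (p ^ i)
      p^≢0 i = m^n≢0 p i {{prime⇒nonZero p-prime}}
      instance
        _ : NonZero (p ^ suc k)
        _ = p^≢0 (suc k)
        _ : NonZero m
        _ = m*n≢0⇒n≢0 (p ^ suc k) {{subst NonZero n≡p^k+1*m _}}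
      p^k+1⊥m : Coprime (p ^ suc k) m
      p^k+1⊥m = coprime-^ˡ (suc k) (prime∤⇒coprime p-prime p∤m)
      1<p^k+1 : 1 < p ^ suc k
      1<p^k+1 = <-≤-trans (prime>1 p-prime) (m≤m*n p (p ^ k) {{p^≢0 k}})
      m<n : m < n
      m<n = subst (m <_) (trans (*-comm m (p ^ suc k)) (sym n≡p^k+1*m)) (m<m*n m (p ^ suc k) 1<p^k+1)

  prime∤product : Prime p → All Prime xs → All (p <_) xs → ¬ p ∣ product xs
  prime∤product {xs = []}     p-prime _ _ p∣1 = ¬prime[1] (subst Prime (∣1⇒≡1 p∣1) p-prime)
  prime∤product {xs = x ∷ xs} p-prime (x-prime ∷ xs-prime) (p<x ∷ p<xs) p∣x*xs
    with euclidsLemma x (product xs) p-prime p∣x*xs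
  ... | inj₁ p∣x  = <-irrefl (prime∣prime⇒≡ p-prime x-prime p∣x) p<x
  ... | inj₂ p∣xs = prime∤product p-prime xs-prime p<xs p∣xs

  product-sortedPrimes∣ : AllPairs _<_ xs → All Prime xs → All (_∣ n) xs → product xs ∣ n
  product-sortedPrimes∣ {xs = []}     _            _                    _            = 1∣ _
  product-sortedPrimes∣ {xs = x ∷ xs} (x<xs ∷ xs↑) (x-prime ∷ xs-prime) (x∣n ∷ xs∣n) =
    coprime⇒*∣ (prime∤⇒coprime x-prime (prime∤product x-prime xs-prime x<xs)) x∣n
               (product-sortedPrimes∣ xs↑ xs-prime xs∣n)

  ^length≤^*product : ∀ c .{{_ : NonZero c}} j {k} xs → AllPairs _<_ xs → All (k <_) xs → c ≤ j + k →
                      c ^ length xs ≤ c ^ j * product xs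
  ^length≤^*product c j [] _ _ _ = subst (1 ≤_) (sym (*-identityʳ (c ^ j))) (m^n>0 c j)
  ^length≤^*product c zero (x ∷ xs) (x<xs ∷ xs↑) (k<x ∷ _) c≤k = begin
    c * c ^ length xs     ≤⟨ *-mono-≤ c≤x (^length≤^*product c 0 xs xs↑ x<xs c≤x) ⟩
    x * (1 * product xs)  ≡⟨ cong (x *_) (*-identityˡ (product xs)) ⟩
    x * product xs        ≡⟨ *-identityˡ (x * product xs) ⟨
    1 * (x * product xs)  ∎
    where
    open ≤-Reasoning
    c≤x : c ≤ x
    c≤x = ≤-trans c≤k (<⇒≤ k<x)
  ^length≤^*product c (suc j) {k} (x ∷ xs) (x<xs ∷ xs↑) (k<x ∷ _) c≤1+j+k = begin
    c * c ^ length xs              ≤⟨ *-monoʳ-≤ c (^length≤^*product c j xs xs↑ x<xs c≤j+x) ⟩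
    c * (c ^ j * product xs)       ≤⟨ *-monoʳ-≤ c (*-monoʳ-≤ (c ^ j) (m≤n*m (product xs) x)) ⟩
    c * (c ^ j * (x * product xs)) ≡⟨ *-assoc c (c ^ j) (x * product xs) ⟨
    c * c ^ j * (x * product xs)   ∎
    where
    open ≤-Reasoning
    instance
      _ : NonZero x
      _ = >-nonZero (<-≤-trans z<s k<x)
    c≤j+x : c ≤ j + x
    c≤j+x = ≤-trans c≤1+j+k (≤-trans (≤-reflexive (sym (+-suc j k))) (+-monoʳ-≤ j k<x))

  Sublinear : (ℕ → ℕ) → Set
  Sublinear A = ∀ k → ∃[ M ] ∀ n → M ≤ n → A n * suc k < n

  square≤linear⇒sublinear : ∀ {A} C → (∀ n → .{{NonZero n}} → A n * A n ≤ C * n) → Sublinear A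
  square≤linear⇒sublinear {A} C A²≤Cn k = suc (C * (K * K)) , λ n M≤n → ≰⇒> λ n≤AK →
    let instance _ = >-nonZero (<-≤-trans z<s M≤n) in
    <-irrefl refl (begin-strict
      n * n                 ≤⟨ *-mono-≤ n≤AK n≤AK ⟩
      A n * K * (A n * K)   ≡⟨ [m*n]*[o*p]≡[m*o]*[n*p] (A n) K (A n) K ⟩
      A n * A n * (K * K)   ≤⟨ *-monoˡ-≤ (K * K) (A²≤Cn n) ⟩
      C * n * (K * K)       ≡⟨ *-assoc C n (K * K) ⟩
      C * (n * (K * K))     ≡⟨ cong (C *_) (*-comm n (K * K)) ⟩
      C * (K * K * n)       ≡⟨ *-assoc C (K * K) n ⟨
      C * (K * K) * n       <⟨ *-monoˡ-< n M≤n ⟩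
      n * n                 ∎)
    where
    open ≤-Reasoning
    K : ℕ
    K = suc k

-- From here on the arithmetic operators are those of ℚ; those of ℕ are qualified.

open import Data.Rational as ℚ using (ℚ; 0ℚ; 1ℚ; _+_; _*_; _-_; -_; _≤_; _<_)
open import Level using (0ℓ)
open import Tactic.RingSolver using (solve-∀)
open import Tactic.RingSolver.Core.AlmostCommutativeRing using (AlmostCommutativeRing; fromCommutativeRing)

private
  ℚ-ring : AlmostCommutativeRing 0ℓ 0ℓ
  ℚ-ring = fromCommutativeRing +-*-commutativeRing (λ x → dec⇒maybe (0ℚ ≟ x))
    where
    open import Data.Rational.Properties using (+-*-commutativeRing; _≟_)
    open import Relation.Nullary.Decidable using (dec⇒maybe)

module _ where
  open import Data.Integer as ℤ using (+_)
  import Data.Integer.Properties as ℤ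
  import Data.Nat.Properties as ℕₚ
  open import Data.Nat.Coprimality using (1-coprimeTo)
  open import Data.Rational using (mkℚ; _/_; *≤*; *<*; toℚᵘ)
  open import Data.Rational.Properties
    using (normalize-coprime; /-cong; toℚᵘ-injective; toℚᵘ-homo-*; toℚᵘ-fromℚᵘ; ≤-trans; +-identityʳ;
           +-monoʳ-≤; *-monoˡ-≤-nonNeg; *-monoʳ-≤-nonNeg; nonNegative⁻¹; nonNeg*nonNeg⇒nonNeg)
  import Data.Rational.Unnormalised as ℚᵘ
  import Data.Rational.Unnormalised.Properties as ℚᵘ

  -- Spelled as in Defs, so that for instance ψ n is ι n times a product, definitionally.
  ι : ℕ → ℚ
  ι n = + n / 1

  private
    ι-canonical : ∀ n → ι n ≡ mkℚ (+ n) 0 (Coprimality.sym (1-coprimeTo n))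
    ι-canonical n = normalize-coprime (Coprimality.sym (1-coprimeTo n))

    +n*1≡+n : ∀ n → + n ℤ.* + 1 ≡ + n
    +n*1≡+n n = ℤ.*-identityʳ (+ n)

  ι-homo-+ : ∀ m n → ι (m ℕ.+ n) ≡ ι m + ι n
  ι-homo-+ m n = trans (/-cong {p₁ = + (m ℕ.+ n)} (sym (cong₂ ℤ._+_ (+n*1≡+n m) (+n*1≡+n n))) refl)
                       (sym (cong₂ _+_ (ι-canonical m) (ι-canonical n)))

  ι-homo-* : ∀ m n → ι (m ℕ.* n) ≡ ι m * ι n
  ι-homo-* m n = trans (/-cong {p₁ = + (m ℕ.* n)} (ℤ.pos-* m n) refl)
                       (sym (cong₂ _*_ (ι-canonical m) (ι-canonical n)))

  ι-mono-≤ : ∀ {m n} → m ℕ.≤ n → ι m ≤ ι n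
  ι-mono-≤ {m} {n} m≤n rewrite ι-canonical m | ι-canonical n =
    *≤* (subst₂ ℤ._≤_ (sym (+n*1≡+n m)) (sym (+n*1≡+n n)) (ℤ.+≤+ m≤n))

  ι-mono-< : ∀ {m n} → m ℕ.< n → ι m < ι n
  ι-mono-< {m} {n} m<n rewrite ι-canonical m | ι-canonical n =
    *<* (subst₂ ℤ._<_ (sym (+n*1≡+n m)) (sym (+n*1≡+n n)) (ℤ.+<+ m<n))

  ι-nonNeg : ∀ n → 0ℚ ≤ ι n
  ι-nonNeg n = ι-mono-≤ {0} {n} ℕ.z≤n

  ι-pos : ∀ n .{{_ : NonZero n}} → 0ℚ < ι n
  ι-pos n = ι-mono-< {0} {n} (ℕ.>-nonZero⁻¹ n)

  n/d*d≡n : ∀ n d → (+ n / suc d) * ι (suc d) ≡ ι n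
  n/d*d≡n n d = toℚᵘ-injective (begin-equality
    toℚᵘ ((+ n / suc d) * ι (suc d))          ≃⟨ toℚᵘ-homo-* (+ n / suc d) (ι (suc d)) ⟩
    toℚᵘ (+ n / suc d) ℚᵘ.* toℚᵘ (ι (suc d))  ≃⟨ ℚᵘ.*-cong (toℚᵘ-fromℚᵘ (ℚᵘ.mkℚᵘ (+ n) d))
                                                            (toℚᵘ-fromℚᵘ (ℚᵘ.mkℚᵘ (+ suc d) 0)) ⟩
    ℚᵘ.mkℚᵘ (+ n) d ℚᵘ.* ℚᵘ.mkℚᵘ (+ suc d) 0  ≃⟨ ℚᵘ.*≡* cross-multiplied ⟩
    ℚᵘ.mkℚᵘ (+ n) 0                           ≃⟨ toℚᵘ-fromℚᵘ (ℚᵘ.mkℚᵘ (+ n) 0) ⟨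
    toℚᵘ (ι n)                                ∎)
    where
    open ℚᵘ.≤-Reasoning
    cross-multiplied : + n ℤ.* + suc d ℤ.* + 1 ≡ + n ℤ.* + (suc d ℕ.* 1)
    cross-multiplied = trans (ℤ.*-identityʳ _) (cong (λ e → + n ℤ.* + e) (sym (ℕₚ.*-identityʳ (suc d))))

  0≤1 : 0ℚ ≤ 1ℚ
  0≤1 = ι-nonNeg 1

  *-nonNeg : ∀ {a b} → 0ℚ ≤ a → 0ℚ ≤ b → 0ℚ ≤ a * b
  *-nonNeg {a} {b} 0≤a 0≤b =
    nonNegative⁻¹ (a * b) {{nonNeg*nonNeg⇒nonNeg a {{ℚ.nonNegative 0≤a}} b {{ℚ.nonNegative 0≤b}}}}

  *-mono-≤-nonNeg : ∀ {a b c d} → 0ℚ ≤ a → a ≤ b → 0ℚ ≤ c → c ≤ d → a * c ≤ b * d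
  *-mono-≤-nonNeg {a} {b} {c} {d} 0≤a a≤b 0≤c c≤d =
    ≤-trans (*-monoʳ-≤-nonNeg c {{ℚ.nonNegative 0≤c}} a≤b)
            (*-monoˡ-≤-nonNeg b {{ℚ.nonNegative (≤-trans 0≤a a≤b)}} c≤d)

  ≤-by-nonNeg-difference : ∀ {x y} e → 0ℚ ≤ e → y ≡ x + e → x ≤ y
  ≤-by-nonNeg-difference {x} e 0≤e y≡x+e =
    subst (x ≤_) (sym y≡x+e) (subst (_≤ x + e) (+-identityʳ x) (+-monoʳ-≤ x 0≤e))

module _ where
  open import Data.List using (_++_; cartesianProduct)
  open import Data.List.Properties using (map-++; map-∘)
  open import Data.List.Relation.Unary.Any using (here; there)
  import Data.List.Relation.Unary.All as All
  import Data.List.Relation.Unary.All.Properties as All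
  open import Data.List.Relation.Unary.AllPairs using ([]; _∷_)
  open import Data.List.Relation.Unary.Unique.Propositional using (Unique)
  open import Data.List.Relation.Binary.Permutation.Propositional using (_↭_; ↭⇒↭ₛ)
  open import Data.List.Relation.Binary.Permutation.Setoid.Properties using (foldr-commMonoid)
  open import Data.List.Membership.Propositional.Properties.WithK using (unique∧set⇒bag)
  open import Data.List.Relation.Binary.BagAndSetEquality using (∼bag⇒↭)
  open import Function.Bundles using (mk⇔)
  open import Data.Rational.Properties
    using (≡-setoid; +-0-isCommutativeMonoid; *-1-isCommutativeMonoid; +-identityˡ; *-identityˡ;
           +-assoc; *-assoc; *-zeroˡ; *-zeroʳ; *-distribˡ-+; *-distribʳ-+)

  unique-↭ : Unique xs → Unique ys →
             (∀ {x} → x ∈ xs → x ∈ ys) → (∀ {x} → x ∈ ys → x ∈ xs) → xs ↭ ys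
  unique-↭ xs! ys! to from = ∼bag⇒↭ (unique∧set⇒bag xs! ys! (mk⇔ to from))

  map-unique : {f : A → B} → Unique xs →
               (∀ {x y} → x ∈ xs → y ∈ xs → f x ≡ f y → x ≡ y) → Unique (map f xs)
  map-unique {xs = []}     []          _   = []
  map-unique {xs = x ∷ xs} (x∉xs ∷ xs!) inj =
    All.map⁺ (All.tabulate λ y∈xs fx≡fy → All.lookup x∉xs y∈xs (inj (here refl) (there y∈xs) fx≡fy))
    ∷ map-unique xs! (λ x∈xs y∈xs → inj (there x∈xs) (there y∈xs))

  sumℚ-↭ : {xs ys : List ℚ} → xs ↭ ys → sumℚ xs ≡ sumℚ ys
  sumℚ-↭ xs↭ys = foldr-commMonoid ≡-setoid +-0-isCommutativeMonoid (↭⇒↭ₛ xs↭ys)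

  prodℚ-↭ : {xs ys : List ℚ} → xs ↭ ys → prodℚ xs ≡ prodℚ ys
  prodℚ-↭ xs↭ys = foldr-commMonoid ≡-setoid *-1-isCommutativeMonoid (↭⇒↭ₛ xs↭ys)

  sumℚ-++ : ∀ (xs ys : List ℚ) → sumℚ (xs ++ ys) ≡ sumℚ xs + sumℚ ys
  sumℚ-++ []       ys = sym (+-identityˡ (sumℚ ys))
  sumℚ-++ (x ∷ xs) ys = trans (cong (x +_) (sumℚ-++ xs ys)) (sym (+-assoc x (sumℚ xs) (sumℚ ys)))

  prodℚ-++ : ∀ (xs ys : List ℚ) → prodℚ (xs ++ ys) ≡ prodℚ xs * prodℚ ys
  prodℚ-++ []       ys = sym (*-identityˡ (prodℚ ys))
  prodℚ-++ (x ∷ xs) ys = trans (cong (x *_) (prodℚ-++ xs ys)) (sym (*-assoc x (prodℚ xs) (prodℚ ys)))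

  sumℚ-zeros : {f : A → ℚ} → All.All (λ x → f x ≡ 0ℚ) xs → sumℚ (map f xs) ≡ 0ℚ
  sumℚ-zeros All.[]              = refl
  sumℚ-zeros (fx≡0 All.∷ fxs≡0) = trans (cong₂ _+_ fx≡0 (sumℚ-zeros fxs≡0)) (+-identityˡ 0ℚ)

  sumℚ-*ˡ : ∀ c (g : A → ℚ) xs → sumℚ (map (λ x → c * g x) xs) ≡ c * sumℚ (map g xs)
  sumℚ-*ˡ c g []       = sym (*-zeroʳ c)
  sumℚ-*ˡ c g (x ∷ xs) = trans (cong (c * g x +_) (sumℚ-*ˡ c g xs)) (sym (*-distribˡ-+ c (g x) _))

  sumℚ-cartesianProduct : ∀ {A B : Set} (f : A → ℚ) (g : B → ℚ) xs ys →
    sumℚ (map (λ (x , y) → f x * g y) (cartesianProduct xs ys)) ≡ sumℚ (map f xs) * sumℚ (map g ys)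
  sumℚ-cartesianProduct f g []       ys = sym (*-zeroˡ (sumℚ (map g ys)))
  sumℚ-cartesianProduct {A} {B} f g (x ∷ xs) ys = begin
    sumℚ (map h (map (x ,_) ys ++ cartesianProduct xs ys))
      ≡⟨ cong sumℚ (map-++ h (map (x ,_) ys) _) ⟩
    sumℚ (map h (map (x ,_) ys) ++ map h (cartesianProduct xs ys))
      ≡⟨ sumℚ-++ (map h (map (x ,_) ys)) _ ⟩
    sumℚ (map h (map (x ,_) ys)) + sumℚ (map h (cartesianProduct xs ys))
      ≡⟨ cong₂ _+_ (trans (cong sumℚ (sym (map-∘ ys))) (sumℚ-*ˡ (f x) g ys))
                   (sumℚ-cartesianProduct f g xs ys) ⟩
    f x * sumℚ (map g ys) + sumℚ (map f xs) * sumℚ (map g ys)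
      ≡⟨ *-distribʳ-+ (sumℚ (map g ys)) (f x) (sumℚ (map f xs)) ⟨
    sumℚ (map f (x ∷ xs)) * sumℚ (map g ys) ∎
    where
    open ≡-Reasoning
    h : A × B → ℚ
    h (x , y) = f x * g y

-- Multiplicative functions

Multiplicative : (ℕ → ℚ) → Set
Multiplicative f = ∀ {a b} .{{_ : NonZero a}} .{{_ : NonZero b}} → Coprime a b → f (a ℕ.* b) ≡ f a * f b

module _ where
  open import Data.Nat.Divisibility using (_∣_; _∣?_; ∣⇒≤; m∣m*n; ∣m⇒∣m*n; ∣n⇒∣m*n)
  open import Data.Nat.Primality using (prime?; prime⇒nonZero; euclidsLemma; ¬prime[1])
  import Data.Nat.Properties as ℕₚ
  open import Data.List using (_++_; filter; upTo)
  open import Data.List.Properties using (map-++)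
  open import Data.List.Membership.Propositional.Properties
    using (∈-filter⁺; ∈-filter⁻; ∈-upTo⁺; ∈-++⁺ˡ; ∈-++⁺ʳ; ∈-++⁻)
  open import Data.List.Relation.Unary.Any using (here)
  import Data.List.Relation.Unary.All as All
  open import Data.List.Relation.Unary.AllPairs using (AllPairs; []; _∷_)
  import Data.List.Relation.Unary.AllPairs.Properties as AllPairs
  open import Data.List.Relation.Unary.Unique.Propositional using (Unique)
  import Data.List.Relation.Unary.Unique.Propositional.Properties as Unique
  open import Data.List.Relation.Binary.Permutation.Propositional using (_↭_)
  open import Data.List.Relation.Binary.Permutation.Propositional.Properties using (map⁺; ↭-singleton-inv)
  open import Data.Rational.Properties using (*-identityʳ)
  open import Data.Sum using (inj₁; inj₂)
  open import Relation.Nullary using (¬_)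
  open import Relation.Nullary.Decidable using (_×-dec_)
  open import Relation.Unary using (Decidable)

  private
    isPrimeDivisor? : ∀ n → Decidable (λ p → Prime p × p ∣ n)
    isPrimeDivisor? n p = prime? p ×-dec (p ∣? n)

  ∈-primeDivisors⁻ : ∀ n → p ∈ primeDivisors n → Prime p × p ∣ n
  ∈-primeDivisors⁻ n p∈ = proj₂ (∈-filter⁻ (isPrimeDivisor? n) {xs = upTo (suc n)} p∈)

  ∈-primeDivisors⁺ : .{{NonZero n}} → Prime p → p ∣ n → p ∈ primeDivisors n
  ∈-primeDivisors⁺ {n} p-prime p∣n = ∈-filter⁺ (isPrimeDivisor? n) (∈-upTo⁺ (ℕ.s≤s (∣⇒≤ p∣n))) (p-prime , p∣n)

  primeDivisors-sorted : ∀ n → AllPairs ℕ._<_ (primeDivisors n)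
  primeDivisors-sorted n =
    AllPairs.filter⁺ (isPrimeDivisor? n) (AllPairs.applyUpTo⁺₁ (λ i → i) (suc n) (λ i<j _ → i<j))

  primeDivisors-unique : ∀ n → Unique (primeDivisors n)
  primeDivisors-unique n = Unique.filter⁺ (isPrimeDivisor? n) (Unique.upTo⁺ (suc n))

  primeDivisors-* : .{{_ : NonZero a}} .{{_ : NonZero b}} → Coprime a b →
                    primeDivisors (a ℕ.* b) ↭ primeDivisors a ++ primeDivisors b
  primeDivisors-* {a} {b} a⊥b = unique-↭ (primeDivisors-unique (a ℕ.* b))
    (Unique.++⁺ (primeDivisors-unique a) (primeDivisors-unique b) disjoint) to from
    where
    instance
      _ : NonZero (a ℕ.* b)
      _ = ℕₚ.m*n≢0 a b
    disjoint : ∀ {p} → ¬ (p ∈ primeDivisors a × p ∈ primeDivisors b)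
    disjoint (p∈a , p∈b) with ∈-primeDivisors⁻ a p∈a | ∈-primeDivisors⁻ b p∈b
    ... | p-prime , p∣a | _ , p∣b = ¬prime[1] (subst Prime (a⊥b (p∣a , p∣b)) p-prime)
    to : ∀ {p} → p ∈ primeDivisors (a ℕ.* b) → p ∈ primeDivisors a ++ primeDivisors b
    to p∈ab with ∈-primeDivisors⁻ (a ℕ.* b) p∈ab
    ... | p-prime , p∣ab with euclidsLemma a b p-prime p∣ab
    ...   | inj₁ p∣a = ∈-++⁺ˡ (∈-primeDivisors⁺ p-prime p∣a)
    ...   | inj₂ p∣b = ∈-++⁺ʳ (primeDivisors a) (∈-primeDivisors⁺ p-prime p∣b)
    from : ∀ {p} → p ∈ primeDivisors a ++ primeDivisors b → p ∈ primeDivisors (a ℕ.* b)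
    from p∈a++b with ∈-++⁻ (primeDivisors a) p∈a++b
    ... | inj₁ p∈a = let p-prime , p∣a = ∈-primeDivisors⁻ a p∈a in ∈-primeDivisors⁺ p-prime (∣m⇒∣m*n b p∣a)
    ... | inj₂ p∈b = let p-prime , p∣b = ∈-primeDivisors⁻ b p∈b in ∈-primeDivisors⁺ p-prime (∣n⇒∣m*n a p∣b)

  primeDivisors-prime^ : Prime p → ∀ k → primeDivisors (p ℕ.^ suc k) ≡ p ∷ []
  primeDivisors-prime^ {p} p-prime k =
    ↭-singleton-inv (unique-↭ (primeDivisors-unique (p ℕ.^ suc k)) (All.[] ∷ []) to from)
    where
    instance
      _ : NonZero (p ℕ.^ suc k)
      _ = ℕₚ.m^n≢0 p (suc k) {{prime⇒nonZero p-prime}}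
    to : ∀ {q} → q ∈ primeDivisors (p ℕ.^ suc k) → q ∈ p ∷ []
    to q∈ = let q-prime , q∣p^k+1 = ∈-primeDivisors⁻ (p ℕ.^ suc k) q∈
            in here (prime∣prime⇒≡ q-prime p-prime (prime∣^⇒∣ (suc k) q-prime q∣p^k+1))
    from : ∀ {q} → q ∈ p ∷ [] → q ∈ primeDivisors (p ℕ.^ suc k)
    from (here refl) = ∈-primeDivisors⁺ p-prime (m∣m*n (p ℕ.^ k))

  prodℚ-primeDivisors-prime^ : Prime p → ∀ f k → prodℚ (map f (primeDivisors (p ℕ.^ suc k))) ≡ f p
  prodℚ-primeDivisors-prime^ {p} p-prime f k =
    trans (cong (λ ps → prodℚ (map f ps)) (primeDivisors-prime^ p-prime k)) (*-identityʳ (f p))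

  prodℚ-primeDivisors-multiplicative : ∀ f → Multiplicative (λ n → prodℚ (map f (primeDivisors n)))
  prodℚ-primeDivisors-multiplicative f {a} a⊥b = trans (prodℚ-↭ (map⁺ f (primeDivisors-* a⊥b)))
    (trans (cong prodℚ (map-++ f (primeDivisors a) _)) (prodℚ-++ (map f (primeDivisors a)) _))

module _ where
  open import Algebra.Bundles using (CommutativeMonoid)
  open import Data.Rational.Properties using (*-1-commutativeMonoid)
  open import Algebra.Properties.CommutativeSemigroup
    (CommutativeMonoid.commutativeSemigroup *-1-commutativeMonoid) using (interchange)
  open import Data.Nat.Divisibility using (_∣_; _∣?_; ∣-refl; ∣m⇒∣m*n)
  open import Data.Nat.Coprimality using (coprime-divisor)
  import Data.Nat.Properties as ℕₚ
  open import Data.List.Properties using (map-cong-local)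
  import Data.List.Relation.Unary.All as All
  open import Relation.Nullary using (yes; no; contradiction)

  *-multiplicative : {f g : ℕ → ℚ} → Multiplicative f → Multiplicative g → Multiplicative (λ n → f n * g n)
  *-multiplicative {f} {g} f-mult g-mult {a} {b} a⊥b =
    trans (cong₂ _*_ (f-mult a⊥b) (g-mult a⊥b)) (interchange (f a) (f b) (g a) (g b))

  ι-multiplicative : Multiplicative ι
  ι-multiplicative {a} {b} _ = ι-homo-* a b

  ψ-multiplicative : Multiplicative ψ
  ψ-multiplicative = *-multiplicative {f = ι} ι-multiplicative (prodℚ-primeDivisors-multiplicative onePlusInv)

  π₂-multiplicative : Multiplicative π₂
  π₂-multiplicative = prodℚ-primeDivisors-multiplicative pOverPm1

  βlocal-cong : (∀ k → p ℕ.^ k ∣ m → p ℕ.^ k ∣ n) → (∀ k → p ℕ.^ k ∣ n → p ℕ.^ k ∣ m) →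
                βlocal m p ≡ βlocal n p
  βlocal-cong {p} {m} {n} m⇒n n⇒m with (p ℕ.^ 3) ∣? m | (p ℕ.^ 3) ∣? n
  ... | yes _    | yes _    = refl
  ... | yes p³∣m | no  p³∤n = contradiction (m⇒n 3 p³∣m) p³∤n
  ... | no  p³∤m | yes p³∣n = contradiction (n⇒m 3 p³∣n) p³∤m
  ... | no  _    | no  _    with (p ℕ.^ 2) ∣? m | (p ℕ.^ 2) ∣? n
  ...   | yes _    | yes _    = refl
  ...   | yes p²∣m | no  p²∤n = contradiction (m⇒n 2 p²∣m) p²∤n
  ...   | no  p²∤m | yes p²∣n = contradiction (n⇒m 2 p²∣n) p²∤m
  ...   | no  _    | no  _    = refl

  βlocal-*-coprime : Coprime a b → p ∣ a → βlocal (a ℕ.* b) p ≡ βlocal a p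
  βlocal-*-coprime {a} {b} {p} a⊥b p∣a = βlocal-cong
    (λ k p^k∣ab → coprime-divisor (coprime-^ˡ k p⊥b) (subst (p ℕ.^ k ∣_) (ℕₚ.*-comm a b) p^k∣ab))
    (λ k → ∣m⇒∣m*n b)
    where
    p⊥b : Coprime p b
    p⊥b = coprime-∣ a⊥b p∣a ∣-refl

  β-multiplicative : Multiplicative β
  β-multiplicative {a} {b} a⊥b = trans (prodℚ-primeDivisors-multiplicative (βlocal (a ℕ.* b)) a⊥b)
    (cong₂ _*_ (cong prodℚ (map-cong-local (All.tabulate local-a)))
               (cong prodℚ (map-cong-local (All.tabulate local-b))))
    where
    local-a : ∀ {p} → p ∈ primeDivisors a → βlocal (a ℕ.* b) p ≡ βlocal a p
    local-a p∈a = βlocal-*-coprime a⊥b (proj₂ (∈-primeDivisors⁻ a p∈a))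
    local-b : ∀ {p} → p ∈ primeDivisors b → βlocal (a ℕ.* b) p ≡ βlocal b p
    local-b {p} p∈b = trans (cong (λ n → βlocal n p) (ℕₚ.*-comm a b))
                            (βlocal-*-coprime (Coprimality.sym a⊥b) (proj₂ (∈-primeDivisors⁻ b p∈b)))

-- Dirichlet convolution

module _ where
  open import Algebra.Bundles using (CommutativeMonoid)
  open import Data.Rational.Properties using (*-1-commutativeMonoid)
  open import Algebra.Properties.CommutativeSemigroup
    (CommutativeMonoid.commutativeSemigroup *-1-commutativeMonoid) using (interchange)
  open import Data.Nat.Divisibility using (_∣_; _∣?_; ∣⇒≤; *-pres-∣; m/n∣m)
  open import Data.Nat.DivMod using (/-*-interchange; /-congˡ; /-congʳ; m*n/n≡m; m≥n⇒m/n>0)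
  open import Data.Nat.GCD using (gcd; gcd[m,n]∣n)
  open import Data.Nat.Primality using (prime⇒nonZero)
  import Data.Nat.Properties as ℕₚ
  open import Data.List using (filter; upTo; cartesianProduct)
  open import Data.List.Properties using (map-∘; map-cong-local)
  open import Data.List.Membership.Propositional.Properties
    using (∈-filter⁺; ∈-filter⁻; ∈-upTo⁺; ∈-upTo⁻; ∈-map⁺; ∈-map⁻; ∈-cartesianProduct⁺; ∈-cartesianProduct⁻)
  import Data.List.Relation.Unary.All as All
  open import Data.List.Relation.Unary.Unique.Propositional using (Unique)
  import Data.List.Relation.Unary.Unique.Propositional.Properties as Unique
  open import Data.List.Relation.Binary.Permutation.Propositional using (_↭_)
  open import Data.List.Relation.Binary.Permutation.Propositional.Properties using (map⁺)
  open import Function using (_∘_)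

  -- `d ∈ shiftedDivisors n` stands for the divisor `suc d` of `n`.  This is the indexing of the
  -- sum defining ψnew, so that ψnew is β ⋆ ψ by definition.
  shiftedDivisors : ℕ → List ℕ
  shiftedDivisors n = filter (λ d → suc d ∣? n) (upTo n)

  _⋆_ : (ℕ → ℚ) → (ℕ → ℚ) → ℕ → ℚ
  (f ⋆ g) n = sumℚ (map (λ d → f (n ℕ./ suc d) * g (suc d)) (shiftedDivisors n))

  ∈-shiftedDivisors⁻ : ∀ n → d ∈ shiftedDivisors n → suc d ∣ n
  ∈-shiftedDivisors⁻ n d∈ = proj₂ (∈-filter⁻ (λ d → suc d ∣? n) {xs = upTo n} d∈)

  ∈-shiftedDivisors⁺ : .{{NonZero n}} → suc d ∣ n → d ∈ shiftedDivisors n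
  ∈-shiftedDivisors⁺ {n} d+1∣n = ∈-filter⁺ (λ d → suc d ∣? n) (∈-upTo⁺ (∣⇒≤ d+1∣n)) d+1∣n

  shiftedDivisors-unique : ∀ n → Unique (shiftedDivisors n)
  shiftedDivisors-unique n = Unique.filter⁺ (λ d → suc d ∣? n) (Unique.upTo⁺ n)

  shifted-* : ℕ × ℕ → ℕ
  shifted-* (x , y) = ℕ.pred (suc x ℕ.* suc y)

  shiftedDivisors-* : .{{_ : NonZero a}} .{{_ : NonZero b}} → Coprime a b →
    shiftedDivisors (a ℕ.* b) ↭ map shifted-* (cartesianProduct (shiftedDivisors a) (shiftedDivisors b))
  shiftedDivisors-* {a} {b} a⊥b =
    unique-↭ (shiftedDivisors-unique (a ℕ.* b))
             (map-unique (Unique.cartesianProduct⁺ (shiftedDivisors-unique a) (shiftedDivisors-unique b)) injective)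
             to from
    where
    instance
      _ : NonZero (a ℕ.* b)
      _ = ℕₚ.m*n≢0 a b
    Da×Db : List (ℕ × ℕ)
    Da×Db = cartesianProduct (shiftedDivisors a) (shiftedDivisors b)
    divides-a×b : ∀ {x y} → (x , y) ∈ Da×Db → suc x ∣ a × suc y ∣ b
    divides-a×b xy∈ = let x∈ , y∈ = ∈-cartesianProduct⁻ (shiftedDivisors a) (shiftedDivisors b) xy∈
                      in ∈-shiftedDivisors⁻ a x∈ , ∈-shiftedDivisors⁻ b y∈
    injective : ∀ {u v} → u ∈ Da×Db → v ∈ Da×Db → shifted-* u ≡ shifted-* v → u ≡ v
    injective {x , y} {x′ , y′} u∈ v∈ eq with divides-a×b u∈ | divides-a×b v∈
    ... | x+1∣a , y+1∣b | x′+1∣a , y′+1∣b =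
      let x+1≡x′+1 , y+1≡y′+1 = coprime-factors-unique a⊥b x+1∣a y+1∣b x′+1∣a y′+1∣b (cong suc eq)
      in cong₂ _,_ (ℕₚ.suc-injective x+1≡x′+1) (ℕₚ.suc-injective y+1≡y′+1)
    to : ∀ {e} → e ∈ shiftedDivisors (a ℕ.* b) → e ∈ map shifted-* Da×Db
    to {e} e∈ = subst (_∈ map shifted-* Da×Db) e≡
      (∈-map⁺ shifted-* (∈-cartesianProduct⁺
        (∈-shiftedDivisors⁺ (subst (_∣ a) (sym (ℕₚ.suc-pred u)) (gcd[m,n]∣n (suc e) a)))
        (∈-shiftedDivisors⁺ (subst (_∣ b) (sym (ℕₚ.suc-pred v)) (gcd[m,n]∣n (suc e) b)))))
      where
      u v : ℕ
      u = gcd (suc e) a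
      v = gcd (suc e) b
      e+1≡uv : suc e ≡ u ℕ.* v
      e+1≡uv = ∣*⇒≡gcd*gcd a⊥b (∈-shiftedDivisors⁻ (a ℕ.* b) e∈)
      instance
        _ : NonZero u
        _ = ℕₚ.m*n≢0⇒m≢0 u {{subst NonZero e+1≡uv _}}
        _ : NonZero v
        _ = ℕₚ.m*n≢0⇒n≢0 u {{subst NonZero e+1≡uv _}}
      e≡ : shifted-* (ℕ.pred u , ℕ.pred v) ≡ e
      e≡ = cong ℕ.pred (trans (cong₂ ℕ._*_ (ℕₚ.suc-pred u) (ℕₚ.suc-pred v)) (sym e+1≡uv))
    from : ∀ {e} → e ∈ map shifted-* Da×Db → e ∈ shiftedDivisors (a ℕ.* b)
    from e∈ with ∈-map⁻ shifted-* e∈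
    ... | (x , y) , xy∈ , refl =
      let x+1∣a , y+1∣b = divides-a×b xy∈ in ∈-shiftedDivisors⁺ (*-pres-∣ x+1∣a y+1∣b)

  ⋆-multiplicative : {f g : ℕ → ℚ} → Multiplicative f → Multiplicative g → Multiplicative (f ⋆ g)
  ⋆-multiplicative {f} {g} f-mult g-mult {a} {b} a⊥b = begin
    sumℚ (map (term (a ℕ.* b)) (shiftedDivisors (a ℕ.* b)))
      ≡⟨ sumℚ-↭ (map⁺ (term (a ℕ.* b)) (shiftedDivisors-* a⊥b)) ⟩
    sumℚ (map (term (a ℕ.* b)) (map shifted-* Da×Db))
      ≡⟨ cong sumℚ (map-∘ {g = term (a ℕ.* b)} {f = shifted-*} Da×Db) ⟨
    sumℚ (map (term (a ℕ.* b) ∘ shifted-*) Da×Db)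
      ≡⟨ cong sumℚ (map-cong-local (All.tabulate term-*)) ⟩
    sumℚ (map (λ (x , y) → term a x * term b y) Da×Db)
      ≡⟨ sumℚ-cartesianProduct (term a) (term b) (shiftedDivisors a) (shiftedDivisors b) ⟩
    (f ⋆ g) a * (f ⋆ g) b ∎
    where
    open ≡-Reasoning
    term : ℕ → ℕ → ℚ
    term n d = f (n ℕ./ suc d) * g (suc d)
    Da×Db : List (ℕ × ℕ)
    Da×Db = cartesianProduct (shiftedDivisors a) (shiftedDivisors b)
    term-* : ∀ {u} → u ∈ Da×Db → term (a ℕ.* b) (shifted-* u) ≡ term a (proj₁ u) * term b (proj₂ u)
    term-* {x , y} u∈ = begin
      f ((a ℕ.* b) ℕ./ (suc x ℕ.* suc y)) * g (suc x ℕ.* suc y)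
        ≡⟨ cong₂ _*_ (cong f (/-*-interchange x+1∣a y+1∣b)) (g-mult (coprime-∣ a⊥b x+1∣a y+1∣b)) ⟩
      f (a ℕ./ suc x ℕ.* (b ℕ./ suc y)) * (g (suc x) * g (suc y))
        ≡⟨ cong (_* (g (suc x) * g (suc y))) (f-mult (coprime-∣ a⊥b (m/n∣m x+1∣a) (m/n∣m y+1∣b))) ⟩
      f (a ℕ./ suc x) * f (b ℕ./ suc y) * (g (suc x) * g (suc y))
        ≡⟨ interchange (f (a ℕ./ suc x)) (f (b ℕ./ suc y)) (g (suc x)) (g (suc y)) ⟩
      term a x * term b y ∎
      where
      x+1∣a : suc x ∣ a
      x+1∣a = ∈-shiftedDivisors⁻ a (proj₁ (∈-cartesianProduct⁻ (shiftedDivisors a) (shiftedDivisors b) u∈))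
      y+1∣b : suc y ∣ b
      y+1∣b = ∈-shiftedDivisors⁻ b (proj₂ (∈-cartesianProduct⁻ (shiftedDivisors a) (shiftedDivisors b) u∈))
      instance
        _ : NonZero (a ℕ./ suc x)
        _ = ℕ.>-nonZero (m≥n⇒m/n>0 (∣⇒≤ x+1∣a))
        _ : NonZero (b ℕ./ suc y)
        _ = ℕ.>-nonZero (m≥n⇒m/n>0 (∣⇒≤ y+1∣b))

  ψnew-multiplicative : Multiplicative ψnew
  ψnew-multiplicative = ⋆-multiplicative {β} {ψ} β-multiplicative ψ-multiplicative

  shiftedDivisors-prime^ : Prime p → ∀ r →
    shiftedDivisors (p ℕ.^ r) ↭ map (λ j → ℕ.pred (p ℕ.^ (r ℕ.∸ j))) (upTo (suc r))
  shiftedDivisors-prime^ {p} p-prime r =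
    unique-↭ (shiftedDivisors-unique (p ℕ.^ r)) (map-unique (Unique.upTo⁺ (suc r)) injective) to from
    where
    p^≢0 : ∀ i → NonZero (p ℕ.^ i)
    p^≢0 i = ℕₚ.m^n≢0 p i {{prime⇒nonZero p-prime}}
    suc-pred-p^ : ∀ i → suc (ℕ.pred (p ℕ.^ i)) ≡ p ℕ.^ i
    suc-pred-p^ i = ℕₚ.suc-pred (p ℕ.^ i) {{p^≢0 i}}
    divisor : ℕ → ℕ
    divisor j = ℕ.pred (p ℕ.^ (r ℕ.∸ j))
    injective : ∀ {i j} → i ∈ upTo (suc r) → j ∈ upTo (suc r) → divisor i ≡ divisor j → i ≡ j
    injective {i} {j} i∈ j∈ eq = ℕₚ.∸-cancelˡ-≡ (ℕₚ.≤-pred (∈-upTo⁻ i∈)) (ℕₚ.≤-pred (∈-upTo⁻ j∈))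
      (^-injectiveʳ (prime>1 p-prime)
        (trans (sym (suc-pred-p^ (r ℕ.∸ i))) (trans (cong suc eq) (suc-pred-p^ (r ℕ.∸ j)))))
    to : ∀ {d} → d ∈ shiftedDivisors (p ℕ.^ r) → d ∈ map divisor (upTo (suc r))
    to {d} d∈ with ∣prime^⇒≡prime^ p-prime r (∈-shiftedDivisors⁻ (p ℕ.^ r) d∈)
    ... | i , i≤r , d+1≡p^i = subst (_∈ map divisor (upTo (suc r))) divisor≡d
                                     (∈-map⁺ divisor (∈-upTo⁺ (ℕ.s≤s (ℕₚ.m∸n≤m r i))))
      where
      divisor≡d : divisor (r ℕ.∸ i) ≡ d
      divisor≡d = trans (cong (λ e → ℕ.pred (p ℕ.^ e)) (ℕₚ.m∸[m∸n]≡n i≤r)) (cong ℕ.pred (sym d+1≡p^i))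
    from : ∀ {d} → d ∈ map divisor (upTo (suc r)) → d ∈ shiftedDivisors (p ℕ.^ r)
    from d∈ with ∈-map⁻ divisor {xs = upTo (suc r)} d∈
    ... | j , _ , refl = ∈-shiftedDivisors⁺ {{p^≢0 r}}
                           (subst (_∣ p ℕ.^ r) (sym (suc-pred-p^ (r ℕ.∸ j))) (^-monoʳ-∣ p (ℕₚ.m∸n≤m r j)))

  ⋆-prime^ : {f g : ℕ → ℚ} → Prime p → ∀ r →
    (f ⋆ g) (p ℕ.^ r) ≡ sumℚ (map (λ j → f (p ℕ.^ j) * g (p ℕ.^ (r ℕ.∸ j))) (upTo (suc r)))
  ⋆-prime^ {p} {f} {g} p-prime r = begin
    sumℚ (map (term (p ℕ.^ r)) (shiftedDivisors (p ℕ.^ r)))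
      ≡⟨ sumℚ-↭ (map⁺ (term (p ℕ.^ r)) (shiftedDivisors-prime^ p-prime r)) ⟩
    sumℚ (map (term (p ℕ.^ r)) (map divisor (upTo (suc r))))
      ≡⟨ cong sumℚ (map-∘ {g = term (p ℕ.^ r)} {f = divisor} (upTo (suc r))) ⟨
    sumℚ (map (term (p ℕ.^ r) ∘ divisor) (upTo (suc r)))
      ≡⟨ cong sumℚ (map-cong-local (All.tabulate term-divisor)) ⟩
    sumℚ (map (λ j → f (p ℕ.^ j) * g (p ℕ.^ (r ℕ.∸ j))) (upTo (suc r))) ∎
    where
    open ≡-Reasoning
    p^≢0 : ∀ i → NonZero (p ℕ.^ i)
    p^≢0 i = ℕₚ.m^n≢0 p i {{prime⇒nonZero p-prime}}
    term : ℕ → ℕ → ℚ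
    term n d = f (n ℕ./ suc d) * g (suc d)
    divisor : ℕ → ℕ
    divisor j = ℕ.pred (p ℕ.^ (r ℕ.∸ j))
    term-divisor : ∀ {j} → j ∈ upTo (suc r) → term (p ℕ.^ r) (divisor j) ≡ f (p ℕ.^ j) * g (p ℕ.^ (r ℕ.∸ j))
    term-divisor {j} j∈ = cong₂ _*_ (cong f quotient≡p^j) (cong g (ℕₚ.suc-pred (p ℕ.^ (r ℕ.∸ j))))
      where
      instance
        _ : NonZero (p ℕ.^ (r ℕ.∸ j))
        _ = p^≢0 (r ℕ.∸ j)
      p^r≡p^j*p^[r∸j] : p ℕ.^ r ≡ p ℕ.^ j ℕ.* p ℕ.^ (r ℕ.∸ j)
      p^r≡p^j*p^[r∸j] = trans (cong (p ℕ.^_) (sym (ℕₚ.m+[n∸m]≡n (ℕₚ.≤-pred (∈-upTo⁻ j∈)))))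
                              (ℕₚ.^-distribˡ-+-* p j (r ℕ.∸ j))
      quotient≡p^j : p ℕ.^ r ℕ./ suc (divisor j) ≡ p ℕ.^ j
      quotient≡p^j = trans (/-congʳ (ℕₚ.suc-pred (p ℕ.^ (r ℕ.∸ j))))
                           (trans (/-congˡ p^r≡p^j*p^[r∸j]) (m*n/n≡m (p ℕ.^ j) (p ℕ.^ (r ℕ.∸ j))))

-- Prime powers, and the bound n ≤ ψnew(n) π₂(n)²

module _ where
  open import Data.Nat.Divisibility using (_∣?_; ∣-refl)
  open import Data.Integer using (+_)
  open import Data.List using (upTo; applyUpTo)
  open import Data.List.Properties using (map-cong)
  open import Data.List.Relation.Unary.All.Properties using (applyUpTo⁺₂)
  open import Data.Rational.Properties
    using (≤-refl; +-mono-≤; *-zeroˡ; *-cancelʳ-≤-pos; pos*pos⇒pos; module ≤-Reasoning)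
  open import Relation.Nullary using (yes; no; contradiction)

  βpow : ℕ → ℚ
  βpow 0                   = 1ℚ
  βpow 1                   = - (1ℚ + 1ℚ)
  βpow 2                   = 1ℚ
  βpow (suc (suc (suc _))) = 0ℚ

  βlocal-prime^ : 1 ℕ.< p → ∀ k → βlocal (p ℕ.^ suc k) p ≡ βpow (suc k)
  βlocal-prime^ {p} 1<p 0 with (p ℕ.^ 3) ∣? (p ℕ.^ 1)
  ... | yes p³∣p = contradiction (^∣^⇒≤ 1<p 3 1 p³∣p) λ { (ℕ.s≤s ()) }
  ... | no  _    with (p ℕ.^ 2) ∣? (p ℕ.^ 1)
  ...   | yes p²∣p = contradiction (^∣^⇒≤ 1<p 2 1 p²∣p) λ { (ℕ.s≤s ()) }
  ...   | no  _    = refl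
  βlocal-prime^ {p} 1<p 1 with (p ℕ.^ 3) ∣? (p ℕ.^ 2)
  ... | yes p³∣p² = contradiction (^∣^⇒≤ 1<p 3 2 p³∣p²) λ { (ℕ.s≤s (ℕ.s≤s ())) }
  ... | no  _     with (p ℕ.^ 2) ∣? (p ℕ.^ 2)
  ...   | yes _     = refl
  ...   | no  p²∤p² = contradiction ∣-refl p²∤p²
  βlocal-prime^ {p} 1<p (suc (suc k)) with (p ℕ.^ 3) ∣? (p ℕ.^ (3 ℕ.+ k))
  ... | yes _     = refl
  ... | no  p³∤pᵏ = contradiction (^-monoʳ-∣ p {3} {3 ℕ.+ k} (ℕ.s≤s (ℕ.s≤s (ℕ.s≤s ℕ.z≤n)))) p³∤pᵏ

  β-prime^ : Prime p → ∀ k → β (p ℕ.^ k) ≡ βpow k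
  β-prime^ p-prime zero    = refl
  β-prime^ {p} p-prime (suc k) =
    trans (prodℚ-primeDivisors-prime^ p-prime (βlocal (p ℕ.^ suc k)) k) (βlocal-prime^ (prime>1 p-prime) k)

  ψ-prime^ : Prime p → ∀ k → ψ (p ℕ.^ suc k) ≡ ι (p ℕ.^ k) * (ι p + 1ℚ)
  ψ-prime^ {p@(suc p-1)} p-prime k = begin
    ι (p ℕ.* p ℕ.^ k) * prodℚ (map onePlusInv (primeDivisors (p ℕ.^ suc k)))
      ≡⟨ cong₂ _*_ (ι-homo-* p (p ℕ.^ k)) (prodℚ-primeDivisors-prime^ p-prime onePlusInv k) ⟩
    ι p * ι (p ℕ.^ k) * (1ℚ + 1/p)
      ≡⟨ rearrange (ι p) (ι (p ℕ.^ k)) 1/p ⟩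
    ι (p ℕ.^ k) * (ι p + 1/p * ι p)
      ≡⟨ cong (λ x → ι (p ℕ.^ k) * (ι p + x)) (n/d*d≡n 1 p-1) ⟩
    ι (p ℕ.^ k) * (ι p + 1ℚ) ∎
    where
    open ≡-Reasoning
    1/p : ℚ
    1/p = + 1 ℚ./ p
    rearrange : ∀ P Q u → P * Q * (1ℚ + u) ≡ Q * (P + u * P)
    rearrange = solve-∀ ℚ-ring

  π₂-prime^ : Prime (2+ q) → ∀ k → π₂ (2+ q ℕ.^ suc k) * ι (suc q) ≡ ι (2+ q)
  π₂-prime^ {q} p-prime k = begin
    π₂ (2+ q ℕ.^ suc k) * ι (suc q)
      ≡⟨ cong (_* ι (suc q)) (prodℚ-primeDivisors-prime^ p-prime pOverPm1 k) ⟩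
    (1ℚ + 1/[p-1]) * ι (suc q)
      ≡⟨ rearrange 1/[p-1] (ι (suc q)) ⟩
    1/[p-1] * ι (suc q) + ι (suc q)
      ≡⟨ cong (_+ ι (suc q)) (n/d*d≡n 1 q) ⟩
    1ℚ + ι (suc q)
      ≡⟨ ι-homo-+ 1 (suc q) ⟨
    ι (2+ q) ∎
    where
    open ≡-Reasoning
    1/[p-1] : ℚ
    1/[p-1] = + 1 ℚ./ suc q
    rearrange : ∀ v W → (1ℚ + v) * W ≡ v * W + W
    rearrange = solve-∀ ℚ-ring

  β⋆-prime^ : ∀ g → Prime p → ∀ r →
    (β ⋆ g) (p ℕ.^ r) ≡ sumℚ (map (λ j → βpow j * g (p ℕ.^ (r ℕ.∸ j))) (upTo (suc r)))
  β⋆-prime^ {p} g p-prime r = trans (⋆-prime^ {f = β} {g} p-prime r)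
    (cong sumℚ (map-cong (λ j → cong (_* g (p ℕ.^ (r ℕ.∸ j))) (β-prime^ p-prime j)) (upTo (suc r))))

  β⋆-prime : ∀ g → Prime p → (β ⋆ g) (p ℕ.^ 1) ≡ g (p ℕ.^ 1) - (1ℚ + 1ℚ) * g 1
  β⋆-prime {p} g p-prime = trans (β⋆-prime^ g p-prime 1) (first-difference (g (p ℕ.^ 1)) (g 1))
    where
    first-difference : ∀ a₁ a₀ → 1ℚ * a₁ + (- (1ℚ + 1ℚ) * a₀ + 0ℚ) ≡ a₁ - (1ℚ + 1ℚ) * a₀
    first-difference = solve-∀ ℚ-ring

  β⋆-prime^[2+k] : ∀ g → Prime p → ∀ k →
    (β ⋆ g) (p ℕ.^ (2 ℕ.+ k)) ≡ g (p ℕ.^ (2 ℕ.+ k)) - (1ℚ + 1ℚ) * g (p ℕ.^ (1 ℕ.+ k)) + g (p ℕ.^ k)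
  β⋆-prime^[2+k] {p} g p-prime k = begin
    (β ⋆ g) (p ℕ.^ (2 ℕ.+ k))
      ≡⟨ β⋆-prime^ g p-prime (2 ℕ.+ k) ⟩
    1ℚ * a₂ + (- (1ℚ + 1ℚ) * a₁ + (1ℚ * a₀ + sumℚ (map term (applyUpTo (3 ℕ.+_) k))))
      ≡⟨ cong (λ t → 1ℚ * a₂ + (- (1ℚ + 1ℚ) * a₁ + (1ℚ * a₀ + t)))
              (sumℚ-zeros (applyUpTo⁺₂ (3 ℕ.+_) k term[3+i]≡0)) ⟩
    1ℚ * a₂ + (- (1ℚ + 1ℚ) * a₁ + (1ℚ * a₀ + 0ℚ))
      ≡⟨ second-difference a₂ a₁ a₀ ⟩
    a₂ - (1ℚ + 1ℚ) * a₁ + a₀ ∎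
    where
    open ≡-Reasoning
    a₂ a₁ a₀ : ℚ
    a₂ = g (p ℕ.^ (2 ℕ.+ k))
    a₁ = g (p ℕ.^ (1 ℕ.+ k))
    a₀ = g (p ℕ.^ k)
    term : ℕ → ℚ
    term j = βpow j * g (p ℕ.^ (2 ℕ.+ k ℕ.∸ j))
    term[3+i]≡0 : ∀ i → term (3 ℕ.+ i) ≡ 0ℚ
    term[3+i]≡0 i = *-zeroˡ (g (p ℕ.^ (2 ℕ.+ k ℕ.∸ (3 ℕ.+ i))))
    second-difference : ∀ a₂ a₁ a₀ → 1ℚ * a₂ + (- (1ℚ + 1ℚ) * a₁ + (1ℚ * a₀ + 0ℚ)) ≡ a₂ - (1ℚ + 1ℚ) * a₁ + a₀
    second-difference = solve-∀ ℚ-ring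

  ψnew-prime : Prime p → ψnew (p ℕ.^ 1) ≡ ι p - 1ℚ
  ψnew-prime {p} p-prime = begin
    ψnew (p ℕ.^ 1)                      ≡⟨ β⋆-prime ψ p-prime ⟩
    ψ (p ℕ.^ 1) - (1ℚ + 1ℚ) * ψ 1       ≡⟨ cong (λ x → x - (1ℚ + 1ℚ) * ψ 1) (ψ-prime^ p-prime 0) ⟩
    ι 1 * (ι p + 1ℚ) - (1ℚ + 1ℚ) * 1ℚ   ≡⟨ simplify (ι p) ⟩
    ι p - 1ℚ                            ∎
    where
    open ≡-Reasoning
    simplify : ∀ P → 1ℚ * (P + 1ℚ) - (1ℚ + 1ℚ) * 1ℚ ≡ P - 1ℚ
    simplify = solve-∀ ℚ-ring

  ψnew-prime² : Prime p → ψnew (p ℕ.^ 2) ≡ ι p * ι p - ι p - 1ℚ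
  ψnew-prime² {p} p-prime = begin
    ψnew (p ℕ.^ 2)
      ≡⟨ β⋆-prime^[2+k] ψ p-prime 0 ⟩
    ψ (p ℕ.^ 2) - (1ℚ + 1ℚ) * ψ (p ℕ.^ 1) + ψ 1
      ≡⟨ cong₂ (λ x y → x - (1ℚ + 1ℚ) * y + 1ℚ) (ψ-prime^ p-prime 1) (ψ-prime^ p-prime 0) ⟩
    ι (p ℕ.* 1) * (ι p + 1ℚ) - (1ℚ + 1ℚ) * (ι 1 * (ι p + 1ℚ)) + 1ℚ
      ≡⟨ cong (λ x → x * (ι p + 1ℚ) - (1ℚ + 1ℚ) * (1ℚ * (ι p + 1ℚ)) + 1ℚ) (ι-homo-* p 1) ⟩
    ι p * 1ℚ * (ι p + 1ℚ) - (1ℚ + 1ℚ) * (1ℚ * (ι p + 1ℚ)) + 1ℚ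
      ≡⟨ simplify (ι p) ⟩
    ι p * ι p - ι p - 1ℚ ∎
    where
    open ≡-Reasoning
    simplify : ∀ P → P * 1ℚ * (P + 1ℚ) - (1ℚ + 1ℚ) * (1ℚ * (P + 1ℚ)) + 1ℚ ≡ P * P - P - 1ℚ
    simplify = solve-∀ ℚ-ring

  ψnew-prime^[3+k] : Prime p → ∀ k →
    ψnew (p ℕ.^ (3 ℕ.+ k)) ≡ ι (p ℕ.^ k) * (ι p + 1ℚ) * ((ι p - 1ℚ) * (ι p - 1ℚ))
  ψnew-prime^[3+k] {p} p-prime k = begin
    ψnew (p ℕ.^ (3 ℕ.+ k))
      ≡⟨ β⋆-prime^[2+k] ψ p-prime (suc k) ⟩
    ψ (p ℕ.^ (3 ℕ.+ k)) - (1ℚ + 1ℚ) * ψ (p ℕ.^ (2 ℕ.+ k)) + ψ (p ℕ.^ (1 ℕ.+ k))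
      ≡⟨ cong₂ _+_ (cong₂ (λ x y → x - (1ℚ + 1ℚ) * y) ψ[p^3+k] ψ[p^2+k]) (ψ-prime^ p-prime k) ⟩
    P * (P * Q) * (P + 1ℚ) - (1ℚ + 1ℚ) * (P * Q * (P + 1ℚ)) + Q * (P + 1ℚ)
      ≡⟨ simplify P Q ⟩
    Q * (P + 1ℚ) * ((P - 1ℚ) * (P - 1ℚ)) ∎
    where
    open ≡-Reasoning
    P Q : ℚ
    P = ι p
    Q = ι (p ℕ.^ k)
    ψ[p^2+k] : ψ (p ℕ.^ (2 ℕ.+ k)) ≡ P * Q * (P + 1ℚ)
    ψ[p^2+k] = trans (ψ-prime^ p-prime (1 ℕ.+ k)) (cong (_* (P + 1ℚ)) (ι-homo-* p (p ℕ.^ k)))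
    ψ[p^3+k] : ψ (p ℕ.^ (3 ℕ.+ k)) ≡ P * (P * Q) * (P + 1ℚ)
    ψ[p^3+k] = trans (ψ-prime^ p-prime (2 ℕ.+ k))
                     (cong (_* (P + 1ℚ))
                           (trans (ι-homo-* p (p ℕ.^ (1 ℕ.+ k))) (cong (P *_) (ι-homo-* p (p ℕ.^ k)))))
    simplify : ∀ P Q → P * (P * Q) * (P + 1ℚ) - (1ℚ + 1ℚ) * (P * Q * (P + 1ℚ)) + Q * (P + 1ℚ)
                       ≡ Q * (P + 1ℚ) * ((P - 1ℚ) * (P - 1ℚ))
    simplify = solve-∀ ℚ-ring

  -- V, W and P stand for p − 2, p − 1 and p; the three bounds are p^r ≤ ψnew(p^r) π₂(p^r)² for
  -- r = 1, 2 and r ≥ 3, multiplied by (p − 1)² to clear the denominators of π₂(p^r) = p/(p − 1).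
  cleared-bound₁ : ∀ {V W P} → W ≡ 1ℚ + V → P ≡ 1ℚ + W → 0ℚ ≤ V →
                   P * 1ℚ * (W * W) ≤ (P - 1ℚ) * (P * P)
  cleared-bound₁ {V} refl refl 0≤V = ≤-by-nonNeg-difference _ (*-nonNeg 0≤P 0≤W) (identity V)
    where
    0≤W : 0ℚ ≤ 1ℚ + V
    0≤W = +-mono-≤ 0≤1 0≤V
    0≤P : 0ℚ ≤ 1ℚ + (1ℚ + V)
    0≤P = +-mono-≤ 0≤1 0≤W
    identity : ∀ V → let W = 1ℚ + V; P = 1ℚ + W in (P - 1ℚ) * (P * P) ≡ P * 1ℚ * (W * W) + P * W
    identity = solve-∀ ℚ-ring

  cleared-bound₂ : ∀ {V W P} → W ≡ 1ℚ + V → P ≡ 1ℚ + W → 0ℚ ≤ V →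
                   P * (P * 1ℚ) * (W * W) ≤ (P * P - P - 1ℚ) * (P * P)
  cleared-bound₂ {V} refl refl 0≤V = ≤-by-nonNeg-difference _ (*-nonNeg (*-nonNeg 0≤P 0≤P) 0≤V) (identity V)
    where
    0≤P : 0ℚ ≤ 1ℚ + (1ℚ + V)
    0≤P = +-mono-≤ 0≤1 (+-mono-≤ 0≤1 0≤V)
    identity : ∀ V → let W = 1ℚ + V; P = 1ℚ + W in
               (P * P - P - 1ℚ) * (P * P) ≡ P * (P * 1ℚ) * (W * W) + P * P * V
    identity = solve-∀ ℚ-ring

  cleared-bound₃ : ∀ {V W P} Q → W ≡ 1ℚ + V → P ≡ 1ℚ + W → 0ℚ ≤ V → 0ℚ ≤ Q →
                   P * (P * (P * Q)) * (W * W) ≤ Q * (P + 1ℚ) * ((P - 1ℚ) * (P - 1ℚ)) * (P * P)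
  cleared-bound₃ {V} Q refl refl 0≤V 0≤Q =
    ≤-by-nonNeg-difference _ (*-nonNeg (*-nonNeg 0≤Q (*-nonNeg 0≤P 0≤P)) (*-nonNeg 0≤W 0≤W)) (identity V Q)
    where
    0≤W : 0ℚ ≤ 1ℚ + V
    0≤W = +-mono-≤ 0≤1 0≤V
    0≤P : 0ℚ ≤ 1ℚ + (1ℚ + V)
    0≤P = +-mono-≤ 0≤1 0≤W
    identity : ∀ V Q → let W = 1ℚ + V; P = 1ℚ + W in
               Q * (P + 1ℚ) * ((P - 1ℚ) * (P - 1ℚ)) * (P * P)
                 ≡ P * (P * (P * Q)) * (W * W) + Q * (P * P) * (W * W)
    identity = solve-∀ ℚ-ring

  prime-power-bound : ∀ k → Prime p →
    ι (p ℕ.^ suc k) ≤ ψnew (p ℕ.^ suc k) * (π₂ (p ℕ.^ suc k) * π₂ (p ℕ.^ suc k))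
  prime-power-bound {p@(2+ q)} k p-prime = *-cancelʳ-≤-pos (W * W) (begin
    ι (p ℕ.^ suc k) * (W * W)
      ≤⟨ cleared k ⟩
    ψnew (p ℕ.^ suc k) * (P * P)
      ≡⟨ cong (λ x → ψnew (p ℕ.^ suc k) * (x * x)) (π₂-prime^ p-prime k) ⟨
    ψnew (p ℕ.^ suc k) * (π₂ (p ℕ.^ suc k) * W * (π₂ (p ℕ.^ suc k) * W))
      ≡⟨ regroup (ψnew (p ℕ.^ suc k)) (π₂ (p ℕ.^ suc k)) W ⟩
    ψnew (p ℕ.^ suc k) * (π₂ (p ℕ.^ suc k) * π₂ (p ℕ.^ suc k)) * (W * W) ∎)
    where
    open ≤-Reasoning
    V W P : ℚ
    V = ι q
    W = ι (suc q)
    P = ι p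
    W≡1+V : W ≡ 1ℚ + V
    W≡1+V = ι-homo-+ 1 q
    P≡1+W : P ≡ 1ℚ + W
    P≡1+W = ι-homo-+ 1 (suc q)
    instance
      _ : ℚ.Positive (W * W)
      _ = pos*pos⇒pos W {{ℚ.positive (ι-pos (suc q))}} W {{ℚ.positive (ι-pos (suc q))}}
    regroup : ∀ X Π W → X * (Π * W * (Π * W)) ≡ X * (Π * Π) * (W * W)
    regroup = solve-∀ ℚ-ring
    cleared : ∀ k → ι (p ℕ.^ suc k) * (W * W) ≤ ψnew (p ℕ.^ suc k) * (P * P)
    cleared 0 = subst₂ _≤_ (cong (_* (W * W)) (sym (ι-homo-* p 1))) (cong (_* (P * P)) (sym (ψnew-prime p-prime)))
                       (cleared-bound₁ W≡1+V P≡1+W (ι-nonNeg q))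
    cleared 1 = subst₂ _≤_ (cong (_* (W * W)) (sym ι[p²])) (cong (_* (P * P)) (sym (ψnew-prime² p-prime)))
                       (cleared-bound₂ W≡1+V P≡1+W (ι-nonNeg q))
      where
      ι[p²] : ι (p ℕ.^ 2) ≡ P * (P * 1ℚ)
      ι[p²] = trans (ι-homo-* p (p ℕ.* 1)) (cong (P *_) (ι-homo-* p 1))
    cleared (suc (suc k)) =
      subst₂ _≤_ (cong (_* (W * W)) (sym ι[p^3+k])) (cong (_* (P * P)) (sym (ψnew-prime^[3+k] p-prime k)))
                 (cleared-bound₃ (ι (p ℕ.^ k)) W≡1+V P≡1+W (ι-nonNeg q) (ι-nonNeg (p ℕ.^ k)))
      where
      ι[p^3+k] : ι (p ℕ.^ (3 ℕ.+ k)) ≡ P * (P * (P * ι (p ℕ.^ k)))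
      ι[p^3+k] = trans (ι-homo-* p (p ℕ.^ (2 ℕ.+ k)))
                       (cong (P *_) (trans (ι-homo-* p (p ℕ.^ (1 ℕ.+ k))) (cong (P *_) (ι-homo-* p (p ℕ.^ k)))))

  multiplicative-≤ : {f g : ℕ → ℚ} → Multiplicative f → Multiplicative g → (∀ n → 0ℚ ≤ f n) → f 1 ≤ g 1 →
    (∀ {p} k → Prime p → f (p ℕ.^ suc k) ≤ g (p ℕ.^ suc k)) → ∀ n → .{{NonZero n}} → f n ≤ g n
  multiplicative-≤ {f} {g} f-mult g-mult 0≤f f[1]≤g[1] f≤g-at-prime-powers =
    prime-power-induction (λ n → f n ≤ g n) f[1]≤g[1] f≤g-at-prime-powers combine
    where
    combine : ∀ {a b} .{{_ : NonZero a}} .{{_ : NonZero b}} → Coprime a b →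
              f a ≤ g a → f b ≤ g b → f (a ℕ.* b) ≤ g (a ℕ.* b)
    combine {a} {b} a⊥b fa≤ga fb≤gb =
      subst₂ _≤_ (sym (f-mult a⊥b)) (sym (g-mult a⊥b)) (*-mono-≤-nonNeg (0≤f a) fa≤ga (0≤f b) fb≤gb)

  ι≤ψnew*π₂² : ∀ n → .{{NonZero n}} → ι n ≤ ψnew n * (π₂ n * π₂ n)
  ι≤ψnew*π₂² = multiplicative-≤ {ι} {λ n → ψnew n * (π₂ n * π₂ n)}
    ι-multiplicative
    (*-multiplicative {ψnew} ψnew-multiplicative (*-multiplicative {π₂} {π₂} π₂-multiplicative π₂-multiplicative))
    ι-nonNeg ≤-refl prime-power-bound

-- Counting prime divisors, and the limits

module _ where
  import Data.Nat.Properties as ℕₚ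
  open import Data.Nat.Divisibility using (_∣_; ∣⇒≤)
  open import Data.Nat.Primality using (prime⇒nonZero)
  open import Data.Integer as ℤ using (+_)
  open import Data.List using (length)
  open import Data.List.Relation.Unary.Any using (here; there)
  import Data.List.Relation.Unary.All as All
  open import Data.Rational using (mkℚ; *<*; ∣_∣)
  open import Data.Rational.Properties
    using (≤-refl; ≤-trans; <-≤-trans; ≤-<-trans; <⇒≤; <-irrefl; +-monoʳ-≤; ↥p/↧p≡p; 0≤p⇒∣p∣≡p; _≟_;
           *-comm; *-assoc; *-identityˡ; *-identityʳ; *-zeroˡ; *-inverseʳ; *-monoʳ-≤-nonNeg; *-monoˡ-≤-nonNeg;
           *-cancelʳ-<-nonNeg; nonNegative⁻¹; normalize-nonNeg; positive⁻¹; 1/pos⇒pos; module ≤-Reasoning)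
  open import Function using (_∘_)
  open import Relation.Nullary using (yes; no; contradiction)

  -- The ω(n) prime divisors of n are distinct, so their product, which divides n,
  -- is at least ω(n)! ≥ c^(ω(n) − c).
  ω-bound : ∀ c .{{_ : NonZero c}} n .{{_ : NonZero n}} → c ℕ.^ ω n ℕ.≤ c ℕ.^ c ℕ.* n
  ω-bound c n = ℕₚ.≤-trans
    (^length≤^*product c c {0} (primeDivisors n) (primeDivisors-sorted n) (All.tabulate (positive ∘ prime))
                       (ℕₚ.m≤m+n c 0))
    (ℕₚ.*-monoʳ-≤ (c ℕ.^ c)
      (∣⇒≤ (product-sortedPrimes∣ (primeDivisors-sorted n) (All.tabulate prime) (All.tabulate divides))))
    where
    prime : ∀ {p} → p ∈ primeDivisors n → Prime p
    prime p∈ = proj₁ (∈-primeDivisors⁻ n p∈)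
    divides : ∀ {p} → p ∈ primeDivisors n → p ∣ n
    divides p∈ = proj₂ (∈-primeDivisors⁻ n p∈)
    positive : ∀ {p} → Prime p → 0 ℕ.< p
    positive {p} p-prime = ℕ.>-nonZero⁻¹ p {{prime⇒nonZero p-prime}}

  pOverPm1-bounds : Prime p → 1ℚ ≤ pOverPm1 p × pOverPm1 p ≤ ι 2
  pOverPm1-bounds {2+ q} _ = ≤-by-nonNeg-difference 1/[p-1] 0≤1/[p-1] refl , +-monoʳ-≤ 1ℚ 1/[p-1]≤1
    where
    1/[p-1] : ℚ
    1/[p-1] = + 1 ℚ./ suc q
    0≤1/[p-1] : 0ℚ ≤ 1/[p-1]
    0≤1/[p-1] = nonNegative⁻¹ 1/[p-1] {{normalize-nonNeg 1 (suc q)}}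
    1/[p-1]≤1 : 1/[p-1] ≤ 1ℚ
    1/[p-1]≤1 = subst₂ _≤_ (*-identityʳ 1/[p-1]) (n/d*d≡n 1 q)
                  (*-monoˡ-≤-nonNeg 1/[p-1] {{ℚ.nonNegative 0≤1/[p-1]}} (ι-mono-≤ {1} {suc q} (ℕ.s≤s ℕ.z≤n)))

  prodℚ-bounds : ∀ (f : A → ℚ) xs → (∀ {x} → x ∈ xs → 1ℚ ≤ f x × f x ≤ ι 2) →
                 1ℚ ≤ prodℚ (map f xs) × prodℚ (map f xs) ≤ ι (2 ℕ.^ length xs)
  prodℚ-bounds f []       _      = ≤-refl , ≤-refl
  prodℚ-bounds f (x ∷ xs) bounds =
    *-mono-≤-nonNeg 0≤1 1≤fx 0≤1 1≤∏ ,
    subst (f x * prodℚ (map f xs) ≤_) (sym (ι-homo-* 2 (2 ℕ.^ length xs)))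
          (*-mono-≤-nonNeg (≤-trans 0≤1 1≤fx) fx≤2 (≤-trans 0≤1 1≤∏) ∏≤2^n)
    where
    1≤fx : 1ℚ ≤ f x
    1≤fx = proj₁ (bounds (here refl))
    fx≤2 : f x ≤ ι 2
    fx≤2 = proj₂ (bounds (here refl))
    1≤∏ : 1ℚ ≤ prodℚ (map f xs)
    1≤∏ = proj₁ (prodℚ-bounds f xs (bounds ∘ there))
    ∏≤2^n : prodℚ (map f xs) ≤ ι (2 ℕ.^ length xs)
    ∏≤2^n = proj₂ (prodℚ-bounds f xs (bounds ∘ there))

  π₂-bounds : ∀ n → 1ℚ ≤ π₂ n × π₂ n ≤ ι (2 ℕ.^ ω n)
  π₂-bounds n = prodℚ-bounds pOverPm1 (primeDivisors n) (λ p∈ → pOverPm1-bounds (proj₁ (∈-primeDivisors⁻ n p∈)))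

  π₂-nonNeg : ∀ n → 0ℚ ≤ π₂ n
  π₂-nonNeg n = ≤-trans (ι-nonNeg 1) (proj₁ (π₂-bounds n))

  π₂²≤4^ω : ∀ n → π₂ n * π₂ n ≤ ι (4 ℕ.^ ω n)
  π₂²≤4^ω n = subst (π₂ n * π₂ n ≤_) 2^ω*2^ω≡4^ω
    (*-mono-≤-nonNeg (π₂-nonNeg n) (proj₂ (π₂-bounds n)) (π₂-nonNeg n) (proj₂ (π₂-bounds n)))
    where
    2^ω*2^ω≡4^ω : ι (2 ℕ.^ ω n) * ι (2 ℕ.^ ω n) ≡ ι (4 ℕ.^ ω n)
    2^ω*2^ω≡4^ω = trans (sym (ι-homo-* (2 ℕ.^ ω n) (2 ℕ.^ ω n))) (cong ι (sym (^-distribʳ-* 2 2 (ω n))))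

  16^ω-sublinear : Sublinear (λ n → 4 ℕ.^ ω n ℕ.* 4 ℕ.^ ω n)
  16^ω-sublinear = square≤linear⇒sublinear {A = λ n → 4 ℕ.^ ω n ℕ.* 4 ℕ.^ ω n} (256 ℕ.^ 256) λ n →
    subst (ℕ._≤ 256 ℕ.^ 256 ℕ.* n) (sym (fourth-power (ω n))) (ω-bound 256 n)
    where
    fourth-power : ∀ w → 4 ℕ.^ w ℕ.* 4 ℕ.^ w ℕ.* (4 ℕ.^ w ℕ.* 4 ℕ.^ w) ≡ 256 ℕ.^ w
    fourth-power w = trans (cong₂ ℕ._*_ (sym (^-distribʳ-* 4 4 w)) (sym (^-distribʳ-* 4 4 w)))
                           (sym (^-distribʳ-* 16 16 w))

  1-sublinear : Sublinear (λ _ → 1)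
  1-sublinear = square≤linear⇒sublinear {A = λ _ → 1} 1 λ n → ℕₚ.*-monoʳ-≤ 1 (ℕ.>-nonZero⁻¹ n)

  tendsToZero-dominated : ∀ f A → Sublinear A →
    (∀ n → .{{NonZero n}} → 0ℚ ≤ f n × f n * ι n ≤ ι (A n)) → TendsToZero f
  tendsToZero-dominated f A A-sublinear bound ε@(mkℚ (+ suc m) d _) _ = M , f<ε
    where
    M : ℕ
    M = proj₁ (A-sublinear d)
    ε*[d+1]≡m+1 : ε * ι (suc d) ≡ ι (suc m)
    ε*[d+1]≡m+1 = trans (cong (_* ι (suc d)) (sym (↥p/↧p≡p ε))) (n/d*d≡n (suc m) d)
    f<ε : ∀ n → 1 ℕ.≤ n → M ℕ.≤ n → ∣ f n ∣ < ε
    f<ε n 1≤n M≤n = subst (_< ε) (sym (0≤p⇒∣p∣≡p (proj₁ (bound n)))) (*-cancelʳ-<-nonNeg (ι n) (begin-strict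
      f n * ι n   ≤⟨ proj₂ (bound n) ⟩
      ι (A n)     <⟨ *-cancelʳ-<-nonNeg (ι (suc d)) A[n]*[d+1]<εn*[d+1] ⟩
      ε * ι n     ∎))
      where
      open ≤-Reasoning
      instance
        _ : NonZero n
        _ = ℕ.>-nonZero 1≤n
        _ : ℚ.NonNegative (ι n)
        _ = ℚ.nonNegative (ι-nonNeg n)
        _ : ℚ.NonNegative (ι (suc d))
        _ = ℚ.nonNegative (ι-nonNeg (suc d))
      A[n]*[d+1]<εn*[d+1] : ι (A n) * ι (suc d) < ε * ι n * ι (suc d)
      A[n]*[d+1]<εn*[d+1] = begin-strict
        ι (A n) * ι (suc d)     ≡⟨ ι-homo-* (A n) (suc d) ⟨
        ι (A n ℕ.* suc d)       <⟨ ι-mono-< (proj₂ (A-sublinear d) n M≤n) ⟩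
        ι n                     ≤⟨ ι-mono-≤ (ℕₚ.m≤m*n n (suc m)) ⟩
        ι (n ℕ.* suc m)         ≡⟨ ι-homo-* n (suc m) ⟩
        ι n * ι (suc m)         ≡⟨ cong (ι n *_) ε*[d+1]≡m+1 ⟨
        ι n * (ε * ι (suc d))   ≡⟨ *-assoc (ι n) ε (ι (suc d)) ⟨
        ι n * ε * ι (suc d)     ≡⟨ cong (_* ι (suc d)) (*-comm (ι n) ε) ⟩
        ε * ι n * ι (suc d)     ∎
  tendsToZero-dominated _ _ _ _ (mkℚ (+ 0) _ _)      (*<* (ℤ.+<+ ()))
  tendsToZero-dominated _ _ _ _ (mkℚ ℤ.-[1+ _ ] _ _) (*<* ())

  tendsToZero-squeeze : ∀ {f g} → (∀ n → .{{NonZero n}} → 0ℚ ≤ f n × f n ≤ g n) → TendsToZero g → TendsToZero f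
  tendsToZero-squeeze {f} {g} between g→0 ε 0<ε = M , f<ε
    where
    M : ℕ
    M = proj₁ (g→0 ε 0<ε)
    f<ε : ∀ n → 1 ℕ.≤ n → M ℕ.≤ n → ∣ f n ∣ < ε
    f<ε n 1≤n M≤n = subst (_< ε) (sym (0≤p⇒∣p∣≡p 0≤fn))
      (≤-<-trans fn≤gn (subst (_< ε) (0≤p⇒∣p∣≡p (≤-trans 0≤fn fn≤gn)) (proj₂ (g→0 ε 0<ε) n 1≤n M≤n)))
      where
      instance
        _ : NonZero n
        _ = ℕ.>-nonZero 1≤n
      0≤fn : 0ℚ ≤ f n
      0≤fn = proj₁ (between n)
      fn≤gn : f n ≤ g n
      fn≤gn = proj₂ (between n)

  recip-nonNeg : ∀ {y} → 0ℚ < y → 0ℚ ≤ recip y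
  recip-nonNeg {y} 0<y with y ≟ 0ℚ
  ... | yes _   = ≤-refl
  ... | no  y≢0 = <⇒≤ (positive⁻¹ _ {{1/pos⇒pos y {{ℚ.positive 0<y}}}})

  recip-inverseʳ : ∀ {y} → 0ℚ < y → y * recip y ≡ 1ℚ
  recip-inverseʳ {y} 0<y with y ≟ 0ℚ
  ... | yes y≡0 = contradiction 0<y (<-irrefl (sym y≡0))
  ... | no  y≢0 = *-inverseʳ y {{ℚ.≢-nonZero y≢0}}

  *-recip-≤ : ∀ {x y z} → 0ℚ < y → x ≤ y * z → x * recip y ≤ z
  *-recip-≤ {x} {y} {z} 0<y x≤yz = begin
    x * recip y         ≤⟨ *-monoʳ-≤-nonNeg (recip y) {{ℚ.nonNegative (recip-nonNeg 0<y)}} x≤yz ⟩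
    y * z * recip y     ≡⟨ cong (_* recip y) (*-comm y z) ⟩
    z * y * recip y     ≡⟨ *-assoc z y (recip y) ⟩
    z * (y * recip y)   ≡⟨ cong (z *_) (recip-inverseʳ 0<y) ⟩
    z * 1ℚ              ≡⟨ *-identityʳ z ⟩
    z                   ∎
    where open ≤-Reasoning

  ψnew-pos : ∀ n → .{{NonZero n}} → 0ℚ < ψnew n
  ψnew-pos n = *-cancelʳ-<-nonNeg (π₂ n * π₂ n) {{ℚ.nonNegative (*-nonNeg (π₂-nonNeg n) (π₂-nonNeg n))}}
    (subst (_< ψnew n * (π₂ n * π₂ n)) (sym (*-zeroˡ (π₂ n * π₂ n)))
           (<-≤-trans (ι-pos n) (ι≤ψnew*π₂² n)))

  θ₁²-dominated : ∀ n → .{{NonZero n}} → 0ℚ ≤ θ₁² n × θ₁² n * ι n ≤ ι 1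
  θ₁²-dominated n = *-nonNeg (ι-nonNeg n) (recip-nonNeg 0<Z) , (begin
    ι n * recip Z * ι n     ≡⟨ regroup (ι n) (recip Z) ⟩
    ι n * ι n * recip Z     ≤⟨ *-recip-≤ 0<Z n²≤Z*1 ⟩
    1ℚ                      ∎)
    where
    open ≤-Reasoning
    Z : ℚ
    Z = ψnew n * ψnew n * (π₂ n * π₂ n * (π₂ n * π₂ n))
    regroup : ∀ a r → a * r * a ≡ a * a * r
    regroup = solve-∀ ℚ-ring
    expand : ∀ X Π → X * (Π * Π) * (X * (Π * Π)) ≡ X * X * (Π * Π * (Π * Π)) * 1ℚ
    expand = solve-∀ ℚ-ring
    n²≤Z*1 : ι n * ι n ≤ Z * 1ℚ
    n²≤Z*1 = subst (ι n * ι n ≤_) (expand (ψnew n) (π₂ n))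
               (*-mono-≤-nonNeg (ι-nonNeg n) (ι≤ψnew*π₂² n) (ι-nonNeg n) (ι≤ψnew*π₂² n))
    0<Z : 0ℚ < Z
    0<Z = <-≤-trans (subst (0ℚ <_) (ι-homo-* n n) (ι-pos (n ℕ.* n) {{ℕₚ.m*n≢0 n n}}))
                    (subst (ι n * ι n ≤_) (*-identityʳ Z) n²≤Z*1)

  θ₂-dominated : ∀ n → .{{NonZero n}} → 0ℚ ≤ θ₂ n × θ₂ n * ι n ≤ ι (4 ℕ.^ ω n ℕ.* 4 ℕ.^ ω n)
  θ₂-dominated n = *-nonNeg (ι-nonNeg 4^ω) (recip-nonNeg (ψnew-pos n)) , (begin
    ι 4^ω * recip (ψnew n) * ι n      ≡⟨ *-assoc (ι 4^ω) (recip (ψnew n)) (ι n) ⟩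
    ι 4^ω * (recip (ψnew n) * ι n)    ≡⟨ cong (ι 4^ω *_) (*-comm (recip (ψnew n)) (ι n)) ⟩
    ι 4^ω * (ι n * recip (ψnew n))    ≤⟨ *-monoˡ-≤-nonNeg (ι 4^ω) {{ℚ.nonNegative (ι-nonNeg 4^ω)}} n/ψnew≤4^ω ⟩
    ι 4^ω * ι 4^ω                     ≡⟨ ι-homo-* 4^ω 4^ω ⟨
    ι (4^ω ℕ.* 4^ω)                   ∎)
    where
    open ≤-Reasoning
    4^ω : ℕ
    4^ω = 4 ℕ.^ ω n
    n/ψnew≤4^ω : ι n * recip (ψnew n) ≤ ι 4^ω
    n/ψnew≤4^ω = *-recip-≤ (ψnew-pos n)
      (≤-trans (ι≤ψnew*π₂² n)
               (*-monoˡ-≤-nonNeg (ψnew n) {{ℚ.nonNegative (<⇒≤ (ψnew-pos n))}} (π₂²≤4^ω n)))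

  0≤θ₃≤θ₂ : ∀ n → .{{NonZero n}} → 0ℚ ≤ θ₃ n × θ₃ n ≤ θ₂ n
  0≤θ₃≤θ₂ n = *-nonNeg (ι-nonNeg (2 ℕ.^ ω n)) 0≤r ,
    *-monoʳ-≤-nonNeg (recip (ψnew n)) {{ℚ.nonNegative 0≤r}}
                     (ι-mono-≤ (ℕₚ.^-monoˡ-≤ (ω n) (ℕ.s≤s (ℕ.s≤s ℕ.z≤n))))
    where
    0≤r : 0ℚ ≤ recip (ψnew n)
    0≤r = recip-nonNeg (ψnew-pos n)

  0≤θ₄≤θ₂ : ∀ n → .{{NonZero n}} → 0ℚ ≤ θ₄ n × θ₄ n ≤ θ₂ n
  0≤θ₄≤θ₂ n = 0≤r , subst (_≤ θ₂ n) (*-identityˡ (recip (ψnew n)))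
    (*-monoʳ-≤-nonNeg (recip (ψnew n)) {{ℚ.nonNegative 0≤r}} (ι-mono-≤ {1} (ℕₚ.m^n>0 4 (ω n))))
    where
    0≤r : 0ℚ ≤ recip (ψnew n)
    0≤r = recip-nonNeg (ψnew-pos n)

lemma4p1 : TendsToZero θ₁² × TendsToZero θ₂ × TendsToZero θ₃ × TendsToZero θ₄
lemma4p1 = tendsToZero-dominated θ₁² (λ _ → 1) 1-sublinear θ₁²-dominated ,
           θ₂→0 ,
           tendsToZero-squeeze 0≤θ₃≤θ₂ θ₂→0 ,
           tendsToZero-squeeze 0≤θ₄≤θ₂ θ₂→0
  where
  θ₂→0 : TendsToZero θ₂
  θ₂→0 = tendsToZero-dominated θ₂ (λ n → 4 ℕ.^ ω n ℕ.* 4 ℕ.^ ω n) 16^ω-sublinear θ₂-dominated
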